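{- Let $\ell$ be an odd prime, $\zeta_\ell\in\mathbb{C}$ a primitive $\ell$-th root of unity, and $\alpha_\ell=\frac{(\zeta_\ell-\zeta_\ell^{ -1})^{2(\ell-1)}}{\ell^2}$. Then $I_{\alpha_\ell}\cong\frac1\ell\mathbb{A}^{(\ell-1)}_{\ell-1}$.
   Context: For a totally real $\beta\in\mathbb{Q}(\zeta_\ell)$, $I_\beta$ is the ideal lattice consisting of $\mathbb{Z}[\zeta_\ell]$ with bilinear form $\langle x,y\rangle_\beta=\mathrm{tr}_{\mathbb{Q}(\zeta_\ell)/\mathbb{Q}}(\beta x\bar y)$ (bar = complex conjugation). Craig's lattice $\mathbb{A}^{(k)}_{\ell-1}$ is (up to isometry) the ideal $\langle1-\zeta_\ell\rangle^k\subseteq\mathbb{Z}[\zeta_\ell]$ with bilinear form $(x,y)\mapsto\mathrm{tr}_{\mathbb{Q}(\zeta_\ell)/\mathbb{Q}}(\tfrac1\ell x\bar y)$. For a lattice $\Lambda$ and rational $c>0$, $c\Lambda$ denotes the same group with bilinear form multiplied by $c$; $\cong$ denotes isometry. -}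

module Defs where

open import Data.Nat as ℕ using (ℕ; zero; suc; NonZero; _∸_; _≟_)
open import Data.Nat.DivMod using (_%_)
open import Data.Integer as ℤ using (ℤ)
open import Data.Rational as ℚ using (ℚ; 0ℚ; 1ℚ; _+_; _*_; -_; _-_; _/_)
open import Data.Fin using (Fin; toℕ)
open import Data.Vec using (Vec; lookup; zipWith)
open import Data.Product using (Σ; ∃; _×_)
open import Relation.Nullary using (yes; no)
open import Relation.Binary.PropositionalEquality using (_≡_)

Σ< : ℕ → (ℕ → ℚ) → ℚ
Σ< zero    f = 0ℚ
Σ< (suc n) f = Σ< n f + f n

ΣFin : (n : ℕ) → (Fin n → ℚ) → ℚ
ΣFin zero    f = 0ℚ
ΣFin (suc n) f = f Data.Fin.zero + ΣFin n (λ i → f (Data.Fin.suc i))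

ℕ→ℚ : ℕ → ℚ
ℕ→ℚ n = ℤ.+ n / 1

ℤ→ℚ : ℤ → ℚ
ℤ→ℚ z = z / 1

-- Arithmetic of ℚ(ζ_ℓ), modelled via the group algebra ℚ[x]/(x^ℓ - 1):
-- an element is a coefficient function a, where a k (k < ℓ) is the coefficient
-- of ζ^k; only indices k < ℓ are ever read.  The map ℚ[x]/(x^ℓ-1) → ℚ(ζ_ℓ)
-- is surjective with kernel spanned by 1 + ζ + ... + ζ^(ℓ-1).
module Cyclotomic (ℓ : ℕ) .{{_ : NonZero ℓ}} where

  K : Set
  K = ℕ → ℚ

  ζ^ : ℕ → K
  ζ^ j k with k ≟ (j % ℓ)
  ... | yes _ = 1ℚ
  ... | no  _ = 0ℚ

  _⊕_ : K → K → K
  (a ⊕ b) k = a k + b k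

  _⊖_ : K → K → K
  (a ⊖ b) k = a k - b k

  _·_ : ℚ → K → K
  (c · a) k = c * a k

  -- multiplication (cyclic convolution, using ζ^ℓ = 1)
  _⊗_ : K → K → K
  (a ⊗ b) k = Σ< ℓ (λ i → a i * b ((k ℕ.+ (ℓ ∸ i)) % ℓ))

  one : K
  one = ζ^ 0

  _^^_ : K → ℕ → K
  a ^^ zero  = one
  a ^^ suc n = a ⊗ (a ^^ n)

  -- complex conjugation: ζ^k ↦ ζ^(-k)
  conj : K → K
  conj a k = a ((ℓ ∸ k) % ℓ)

  -- tr_{ℚ(ζ_ℓ)/ℚ}(ζ^k) = ℓ - 1 if ℓ ∣ k, and -1 otherwise
  trζ^ : ℕ → ℚ
  trζ^ k with k % ℓ ≟ 0
  ... | yes _ = ℕ→ℚ (ℓ ∸ 1)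
  ... | no  _ = - 1ℚ

  tr : K → ℚ
  tr a = Σ< ℓ (λ k → a k * trζ^ k)

  -- equality in ℚ(ζ_ℓ): difference is a multiple of 1 + ζ + ... + ζ^(ℓ-1)
  _≈_ : K → K → Set
  a ≈ b = ∀ i j → i ℕ.< ℓ → j ℕ.< ℓ → a i - b i ≡ a j - b j

  -- ℤ[ζ_ℓ], as a free ℤ-module with the power basis 1, ζ, ..., ζ^(ℓ-2)
  ℤ[ζ] : Set
  ℤ[ζ] = Vec ℤ (ℓ ∸ 1)

  emb : ℤ[ζ] → K
  emb x k = ΣFin (ℓ ∸ 1) (λ i → ℤ→ℚ (lookup x i) * ζ^ (toℕ i) k)

  _+ℤ[ζ]_ : ℤ[ζ] → ℤ[ζ] → ℤ[ζ]
  x +ℤ[ζ] y = zipWith ℤ._+_ x y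

  α : K
  α = ((ℤ.+ 1 / ℓ) * (ℤ.+ 1 / ℓ)) · ((ζ^ 1 ⊖ ζ^ (ℓ ∸ 1)) ^^ (2 ℕ.* (ℓ ∸ 1)))

  ⟨_,_⟩[_] : ℤ[ζ] → ℤ[ζ] → K → ℚ
  ⟨ x , y ⟩[ β ] = tr (β ⊗ (emb x ⊗ conj (emb y)))

  -- Craig's lattice 𝔸^(k)_{ℓ-1}: the ideal ⟨1 - ζ⟩^k ⊆ ℤ[ζ] ...
  InCraigIdeal : ℕ → ℤ[ζ] → Set
  InCraigIdeal k x = Σ ℤ[ζ] (λ y → emb x ≈ (((one ⊖ ζ^ 1) ^^ k) ⊗ emb y))

  craigForm : ℤ[ζ] → ℤ[ζ] → ℚ
  craigForm x y = tr ((ℤ.+ 1 / ℓ) · (emb x ⊗ conj (emb y)))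

  -- I_β ≅ c · 𝔸^(k)_{ℓ-1}: a ℤ-linear bijection f from ℤ[ζ] onto the ideal
  -- ⟨1-ζ⟩^k with ⟨x,y⟩_β = c · craigForm (f x) (f y)
  IsometricToScaledCraig : K → ℚ → ℕ → Set
  IsometricToScaledCraig β c k =
    Σ (ℤ[ζ] → ℤ[ζ]) λ f →
        (∀ x y → f (x +ℤ[ζ] y) ≡ f x +ℤ[ζ] f y)
      × (∀ x y → f x ≡ f y → x ≡ y)
      × (∀ x → InCraigIdeal k (f x))
      × (∀ z → InCraigIdeal k z → ∃ λ x → f x ≡ z)
      × (∀ x y → ⟨ x , y ⟩[ β ] ≡ c * craigForm (f x) (f y))

module Submission where

-- Write ζ for ζ_ℓ and n = ℓ - 1, and let γ = (ζ - ζ⁻¹)^n. Since ζ - ζ⁻¹ = -ζ⁻¹ (1 - ζ) (1 + ζ)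
-- and, ℓ being odd, ζ⁻¹ (1 + ζ) is a unit of ℤ[ζ], the element γ generates the ideal ⟨1 - ζ⟩^n;
-- so x ↦ γ x is a ℤ-linear bijection from ℤ[ζ] onto ⟨1 - ζ⟩^n. As n is even, γ̄ = γ, hence
-- α_ℓ = γ γ̄ / ℓ² and tr(α_ℓ x ȳ) = (1/ℓ) · tr((1/ℓ) (γ x) (γ y)‾): multiplication by γ is the isometry.

open import Defs
open import Data.Nat using (ℕ; zero; suc; NonZero; _+_; _*_; _∸_; _<_; _≤_; z≤n; s≤s; _≟_; _<?_; >-nonZero⁻¹; nonTrivial⇒n>1)
import Data.Nat.Properties as ℕₚ
open import Data.Nat.DivMod using (_%_; %-distribˡ-+; [m+n]%n≡m%n; [m+kn]%n≡m%n; m%n%n≡m%n; m<n⇒m%n≡m; m%n<n; n%n≡0)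
open import Data.Nat.Divisibility using (divides)
open import Data.Nat.Primality using (Prime; composite-≢; prime⇒nonZero; prime⇒nonTrivial)
open import Data.Integer as ℤ using (ℤ; +_)
import Data.Integer.Properties as ℤₚ
open import Data.Rational as ℚ using (ℚ; 0ℚ; 1ℚ; _/_)
import Data.Rational.Properties as ℚₚ
open import Data.Rational.Solver using (module +-*-Solver)
import Data.Rational.Unnormalised as ℚᵘ
import Data.Rational.Unnormalised.Properties as ℚᵘₚ
open import Data.Fin as Fin using (Fin; toℕ)
import Data.Fin.Properties as Finₚ
open import Data.Vec using (Vec; []; _∷_; lookup; tabulate; zipWith)
import Data.Vec.Properties as Vecₚ
open import Data.Product using (Σ; _,_; proj₁; proj₂)
open import Data.Sum using (_⊎_; inj₁; inj₂)
open import Level using (0ℓ)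
open import Algebra.Bundles using (CommutativeMonoid)
import Algebra.Properties.CommutativeSemigroup as CommutativeSemigroupProperties
open import Algebra.Properties.CommutativeSemigroup ℕₚ.+-commutativeSemigroup
  using () renaming (interchange to +-interchange)
import Relation.Binary.Reasoning.Setoid as SetoidReasoning
open import Relation.Binary.PropositionalEquality
  using (_≡_; _≢_; refl; sym; trans; cong; cong₂; subst; ≢-sym; module ≡-Reasoning)
open import Relation.Nullary using (Dec; yes; no; contradiction)

open +-*-Solver

-- ℚ's arithmetic is specified through toℚᵘ, under which ℤ→ℚ z is the fraction z/1
toℚᵘ-ℤ→ℚ : ∀ z → ℚ.toℚᵘ (ℤ→ℚ z) ℚᵘ.≃ ℚᵘ.mkℚᵘ z 0
toℚᵘ-ℤ→ℚ z = ℚₚ.toℚᵘ-fromℚᵘ (ℚᵘ.mkℚᵘ z 0)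

ℤ→ℚ-homo-+ : ∀ a b → ℤ→ℚ (a ℤ.+ b) ≡ ℤ→ℚ a ℚ.+ ℤ→ℚ b
ℤ→ℚ-homo-+ a b = ℚₚ.toℚᵘ-injective (ℚᵘₚ.≃-trans (toℚᵘ-ℤ→ℚ (a ℤ.+ b)) (ℚᵘₚ.≃-trans unnormalised
    (ℚᵘₚ.≃-sym (ℚᵘₚ.≃-trans (ℚₚ.toℚᵘ-homo-+ (ℤ→ℚ a) (ℤ→ℚ b)) (ℚᵘₚ.+-cong (toℚᵘ-ℤ→ℚ a) (toℚᵘ-ℤ→ℚ b))))))
  where
  unnormalised : ℚᵘ.mkℚᵘ (a ℤ.+ b) 0 ℚᵘ.≃ (ℚᵘ.mkℚᵘ a 0 ℚᵘ.+ ℚᵘ.mkℚᵘ b 0)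
  unnormalised = ℚᵘ.*≡* (cong (ℤ._* + 1) (sym (cong₂ ℤ._+_ (ℤₚ.*-identityʳ a) (ℤₚ.*-identityʳ b))))

ℤ→ℚ-homo-* : ∀ a b → ℤ→ℚ (a ℤ.* b) ≡ ℤ→ℚ a ℚ.* ℤ→ℚ b
ℤ→ℚ-homo-* a b = ℚₚ.toℚᵘ-injective (ℚᵘₚ.≃-trans (toℚᵘ-ℤ→ℚ (a ℤ.* b)) (ℚᵘₚ.≃-trans (ℚᵘ.*≡* refl)
    (ℚᵘₚ.≃-sym (ℚᵘₚ.≃-trans (ℚₚ.toℚᵘ-homo-* (ℤ→ℚ a) (ℤ→ℚ b)) (ℚᵘₚ.*-cong (toℚᵘ-ℤ→ℚ a) (toℚᵘ-ℤ→ℚ b))))))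

ℤ→ℚ-homo‿- : ∀ a → ℤ→ℚ (ℤ.- a) ≡ ℚ.- ℤ→ℚ a
ℤ→ℚ-homo‿- a = ℚₚ.toℚᵘ-injective (ℚᵘₚ.≃-trans (toℚᵘ-ℤ→ℚ (ℤ.- a)) (ℚᵘₚ.≃-trans (ℚᵘ.*≡* refl)
    (ℚᵘₚ.≃-sym (ℚᵘₚ.≃-trans (ℚₚ.toℚᵘ-homo‿- (ℤ→ℚ a)) (ℚᵘₚ.-‿cong (toℚᵘ-ℤ→ℚ a))))))

ℤ→ℚ-homo-- : ∀ a b → ℤ→ℚ (a ℤ.- b) ≡ ℤ→ℚ a ℚ.- ℤ→ℚ b
ℤ→ℚ-homo-- a b = trans (ℤ→ℚ-homo-+ a (ℤ.- b)) (cong (ℤ→ℚ a ℚ.+_) (ℤ→ℚ-homo‿- b))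

ℤ→ℚ-injective : ∀ {a b} → ℤ→ℚ a ≡ ℤ→ℚ b → a ≡ b
ℤ→ℚ-injective {a} {b} eq
  with ℚᵘₚ.≃-trans (ℚᵘₚ.≃-sym (toℚᵘ-ℤ→ℚ a)) (ℚᵘₚ.≃-trans (ℚₚ.toℚᵘ-cong eq) (toℚᵘ-ℤ→ℚ b))
... | ℚᵘ.*≡* a*1≡b*1 = trans (sym (ℤₚ.*-identityʳ a)) (trans a*1≡b*1 (ℤₚ.*-identityʳ b))

ℕ→ℚ-suc : ∀ n → ℕ→ℚ (suc n) ≡ ℕ→ℚ n ℚ.+ 1ℚ
ℕ→ℚ-suc n = trans (cong (λ m → ℤ→ℚ (+ m)) (ℕₚ.+-comm 1 n)) (ℤ→ℚ-homo-+ (+ n) (+ 1))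

ℕ→ℚ-*-1/ : ∀ n .{{_ : NonZero n}} → ℕ→ℚ n ℚ.* (+ 1 / n) ≡ 1ℚ
ℕ→ℚ-*-1/ (suc n) = ℚₚ.toℚᵘ-injective (ℚᵘₚ.≃-trans (ℚₚ.toℚᵘ-homo-* (ℕ→ℚ (suc n)) (+ 1 / suc n))
  (ℚᵘₚ.≃-trans (ℚᵘₚ.*-cong (toℚᵘ-ℤ→ℚ (+ suc n)) (ℚₚ.toℚᵘ-fromℚᵘ (ℚᵘ.mkℚᵘ (+ 1) n)))
    (ℚᵘ.*≡* (cong (λ m → + suc m) (trans (ℕₚ.*-identityʳ (n * 1)) (trans (ℕₚ.*-identityʳ n)
      (sym (trans (ℕₚ.+-identityʳ (n + 0)) (ℕₚ.+-identityʳ n)))))))))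

Σ<-cong-< : ∀ n {f g : ℕ → ℚ} → (∀ k → k < n → f k ≡ g k) → Σ< n f ≡ Σ< n g
Σ<-cong-< zero    f≡g = refl
Σ<-cong-< (suc n) f≡g = cong₂ ℚ._+_ (Σ<-cong-< n (λ k k<n → f≡g k (ℕₚ.m<n⇒m<1+n k<n))) (f≡g n ℕₚ.≤-refl)

Σ<-cong : ∀ n {f g : ℕ → ℚ} → (∀ k → f k ≡ g k) → Σ< n f ≡ Σ< n g
Σ<-cong n f≡g = Σ<-cong-< n (λ k _ → f≡g k)

Σ<-zero : ∀ n {f : ℕ → ℚ} → (∀ k → k < n → f k ≡ 0ℚ) → Σ< n f ≡ 0ℚ
Σ<-zero zero    f≡0 = refl
Σ<-zero (suc n) f≡0 = cong₂ ℚ._+_ (Σ<-zero n (λ k k<n → f≡0 k (ℕₚ.m<n⇒m<1+n k<n))) (f≡0 n ℕₚ.≤-refl)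

Σ<-distrib-+ : ∀ n (f g : ℕ → ℚ) → Σ< n (λ k → f k ℚ.+ g k) ≡ Σ< n f ℚ.+ Σ< n g
Σ<-distrib-+ zero    f g = refl
Σ<-distrib-+ (suc n) f g = trans (cong (ℚ._+ (f n ℚ.+ g n)) (Σ<-distrib-+ n f g))
  (solve 4 (λ a b c d → (a :+ b) :+ (c :+ d) := (a :+ c) :+ (b :+ d)) refl (Σ< n f) (Σ< n g) (f n) (g n))

Σ<-distribˡ-* : ∀ n c (f : ℕ → ℚ) → Σ< n (λ k → c ℚ.* f k) ≡ c ℚ.* Σ< n f
Σ<-distribˡ-* zero    c f = sym (ℚₚ.*-zeroʳ c)
Σ<-distribˡ-* (suc n) c f =
  trans (cong (ℚ._+ (c ℚ.* f n)) (Σ<-distribˡ-* n c f)) (sym (ℚₚ.*-distribˡ-+ c (Σ< n f) (f n)))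

Σ<-distribʳ-* : ∀ n c (f : ℕ → ℚ) → Σ< n (λ k → f k ℚ.* c) ≡ Σ< n f ℚ.* c
Σ<-distribʳ-* n c f =
  trans (Σ<-cong n (λ k → ℚₚ.*-comm (f k) c)) (trans (Σ<-distribˡ-* n c f) (ℚₚ.*-comm c _))

Σ<-distrib-- : ∀ n (f g : ℕ → ℚ) → Σ< n (λ k → f k ℚ.- g k) ≡ Σ< n f ℚ.- Σ< n g
Σ<-distrib-- zero    f g = refl
Σ<-distrib-- (suc n) f g = trans (cong (ℚ._+ (f n ℚ.- g n)) (Σ<-distrib-- n f g))
  (solve 4 (λ a b c d → (a :- b) :+ (c :- d) := (a :+ c) :- (b :+ d)) refl (Σ< n f) (Σ< n g) (f n) (g n))

Σ<-const : ∀ n c → Σ< n (λ _ → c) ≡ ℕ→ℚ n ℚ.* c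
Σ<-const zero    c = sym (ℚₚ.*-zeroˡ c)
Σ<-const (suc n) c = begin
  Σ< n (λ _ → c) ℚ.+ c ≡⟨ cong (ℚ._+ c) (Σ<-const n c) ⟩
  ℕ→ℚ n ℚ.* c ℚ.+ c    ≡⟨ solve 2 (λ m x → m :* x :+ x := (m :+ con 1ℚ) :* x) refl (ℕ→ℚ n) c ⟩
  (ℕ→ℚ n ℚ.+ 1ℚ) ℚ.* c ≡⟨ cong (ℚ._* c) (sym (ℕ→ℚ-suc n)) ⟩
  ℕ→ℚ (suc n) ℚ.* c    ∎
  where open ≡-Reasoning

Σ<-comm : ∀ n m (f : ℕ → ℕ → ℚ) →
          Σ< n (λ i → Σ< m (λ j → f i j)) ≡ Σ< m (λ j → Σ< n (λ i → f i j))
Σ<-comm zero    m f = sym (Σ<-zero m (λ _ _ → refl))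
Σ<-comm (suc n) m f = trans (cong (ℚ._+ Σ< m (f n)) (Σ<-comm n m f))
  (sym (Σ<-distrib-+ m (λ j → Σ< n (λ i → f i j)) (f n)))

Σ<-suc : ∀ n (f : ℕ → ℚ) → Σ< (suc n) f ≡ f 0 ℚ.+ Σ< n (λ i → f (suc i))
Σ<-suc zero    f = trans (ℚₚ.+-identityˡ (f 0)) (sym (ℚₚ.+-identityʳ (f 0)))
Σ<-suc (suc n) f = trans (cong (ℚ._+ f (suc n)) (Σ<-suc n f)) (ℚₚ.+-assoc (f 0) _ _)

Σ<-+ : ∀ a b (f : ℕ → ℚ) → Σ< (a + b) f ≡ Σ< a f ℚ.+ Σ< b (λ j → f (a + j))
Σ<-+ a zero    f = trans (cong (λ n → Σ< n f) (ℕₚ.+-identityʳ a)) (sym (ℚₚ.+-identityʳ _))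
Σ<-+ a (suc b) f = begin
  Σ< (a + suc b) f                                 ≡⟨ cong (λ n → Σ< n f) (ℕₚ.+-suc a b) ⟩
  Σ< (a + b) f ℚ.+ f (a + b)                       ≡⟨ cong (ℚ._+ f (a + b)) (Σ<-+ a b f) ⟩
  (Σ< a f ℚ.+ Σ< b (λ j → f (a + j))) ℚ.+ f (a + b) ≡⟨ ℚₚ.+-assoc (Σ< a f) _ _ ⟩
  Σ< a f ℚ.+ Σ< (suc b) (λ j → f (a + j))          ∎
  where open ≡-Reasoning

Σ<-reverse : ∀ n (f : ℕ → ℚ) → Σ< n (λ i → f (n ∸ suc i)) ≡ Σ< n f
Σ<-reverse zero    f = refl
Σ<-reverse (suc n) f = begin
  Σ< n (λ i → f (suc n ∸ suc i)) ℚ.+ f (n ∸ n)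
    ≡⟨ cong₂ ℚ._+_ (Σ<-cong-< n (λ i i<n → cong f (ℕₚ.+-∸-assoc 1 i<n))) (cong f (ℕₚ.n∸n≡0 n)) ⟩
  Σ< n (λ i → f (suc (n ∸ suc i))) ℚ.+ f 0
    ≡⟨ cong (ℚ._+ f 0) (Σ<-reverse n (λ i → f (suc i))) ⟩
  Σ< n (λ i → f (suc i)) ℚ.+ f 0
    ≡⟨ ℚₚ.+-comm _ (f 0) ⟩
  f 0 ℚ.+ Σ< n (λ i → f (suc i))
    ≡⟨ sym (Σ<-suc n f) ⟩
  Σ< (suc n) f ∎
  where open ≡-Reasoning

Σ<-single : ∀ n q {f : ℕ → ℚ} → q < n → (∀ i → i < n → i ≢ q → f i ≡ 0ℚ) → Σ< n f ≡ f q
Σ<-single (suc n) q {f} q<1+n f≡0 with q ≟ n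
... | yes refl = trans (cong (ℚ._+ f q) (Σ<-zero n (λ i i<n → f≡0 i (ℕₚ.m<n⇒m<1+n i<n) (ℕₚ.<⇒≢ i<n))))
                       (ℚₚ.+-identityˡ (f q))
... | no q≢n = trans (cong₂ ℚ._+_ (Σ<-single n q (ℕₚ.≤∧≢⇒< (ℕₚ.≤-pred q<1+n) q≢n) (λ i i<n → f≡0 i (ℕₚ.m<n⇒m<1+n i<n)))
                                 (f≡0 n ℕₚ.≤-refl (≢-sym q≢n)))
                     (ℚₚ.+-identityʳ (f q))

ΣFin-cong : ∀ n {f g : Fin n → ℚ} → (∀ i → f i ≡ g i) → ΣFin n f ≡ ΣFin n g
ΣFin-cong zero    f≡g = refl
ΣFin-cong (suc n) f≡g = cong₂ ℚ._+_ (f≡g Fin.zero) (ΣFin-cong n (λ i → f≡g (Fin.suc i)))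

ΣFin-toℕ : ∀ n (f : ℕ → ℚ) → ΣFin n (λ i → f (toℕ i)) ≡ Σ< n f
ΣFin-toℕ zero    f = refl
ΣFin-toℕ (suc n) f = trans (cong (f 0 ℚ.+_) (ΣFin-toℕ n (λ j → f (suc j)))) (sym (Σ<-suc n f))

Σ<ℤ : ℕ → (ℕ → ℤ) → ℤ
Σ<ℤ zero    f = + 0
Σ<ℤ (suc n) f = Σ<ℤ n f ℤ.+ f n

ℤ→ℚ-homo-Σ< : ∀ n f → ℤ→ℚ (Σ<ℤ n f) ≡ Σ< n (λ k → ℤ→ℚ (f k))
ℤ→ℚ-homo-Σ< zero    f = refl
ℤ→ℚ-homo-Σ< (suc n) f = trans (ℤ→ℚ-homo-+ (Σ<ℤ n f) (f n)) (cong (ℚ._+ ℤ→ℚ (f n)) (ℤ→ℚ-homo-Σ< n f))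

coeff : ∀ {n} → Vec ℤ n → ℕ → ℤ
coeff []       j       = + 0
coeff (a ∷ as) zero    = a
coeff (a ∷ as) (suc j) = coeff as j

lookup≡coeff : ∀ {n} (v : Vec ℤ n) (i : Fin n) → lookup v i ≡ coeff v (toℕ i)
lookup≡coeff (a ∷ v) Fin.zero    = refl
lookup≡coeff (a ∷ v) (Fin.suc i) = lookup≡coeff v i

coeff-≥ : ∀ {n} (v : Vec ℤ n) j → n ≤ j → coeff v j ≡ + 0
coeff-≥ []      j       _         = refl
coeff-≥ (a ∷ v) (suc j) (s≤s n≤j) = coeff-≥ v j n≤j

coeff-zipWith-+ : ∀ {n} (x y : Vec ℤ n) j → coeff (zipWith ℤ._+_ x y) j ≡ coeff x j ℤ.+ coeff y j
coeff-zipWith-+ []      []      j       = refl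
coeff-zipWith-+ (a ∷ x) (b ∷ y) zero    = refl
coeff-zipWith-+ (a ∷ x) (b ∷ y) (suc j) = coeff-zipWith-+ x y j

coeff-injective : ∀ {n} {x y : Vec ℤ n} → (∀ j → j < n → coeff x j ≡ coeff y j) → x ≡ y
coeff-injective {x = []}    {[]}    _           = refl
coeff-injective {x = a ∷ x} {b ∷ y} same-coeff =
  cong₂ _∷_ (same-coeff 0 (s≤s z≤n)) (coeff-injective (λ j j<n → same-coeff (suc j) (s≤s j<n)))

coeff-tabulate : ∀ {n} (g : Fin n → ℤ) j (j<n : j < n) → coeff (tabulate g) j ≡ g (Fin.fromℕ< j<n)
coeff-tabulate g j j<n = begin
  coeff (tabulate g) j                       ≡⟨ cong (coeff (tabulate g)) (sym (Finₚ.toℕ-fromℕ< j<n)) ⟩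
  coeff (tabulate g) (toℕ (Fin.fromℕ< j<n)) ≡⟨ sym (lookup≡coeff (tabulate g) (Fin.fromℕ< j<n)) ⟩
  lookup (tabulate g) (Fin.fromℕ< j<n)      ≡⟨ Vecₚ.lookup∘tabulate g (Fin.fromℕ< j<n) ⟩
  g (Fin.fromℕ< j<n)                         ∎
  where open ≡-Reasoning

module IndexArithmetic (ℓ : ℕ) .{{_ : NonZero ℓ}} where

  0<ℓ : 0 < ℓ
  0<ℓ = >-nonZero⁻¹ ℓ

  ℓ-1<ℓ : ℓ ∸ 1 < ℓ
  ℓ-1<ℓ = subst (ℓ ∸ 1 <_) (ℕₚ.suc-pred ℓ) ℕₚ.≤-refl

  infix 4 _≡ₘ_
  _≡ₘ_ : ℕ → ℕ → Set
  a ≡ₘ b = a % ℓ ≡ b % ℓ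

  -- Cyclotomic's _⊗_ and conj read their argument at k ⊟ i and 0 ⊟ k, definitionally
  infixl 7 _⊟_
  _⊟_ : ℕ → ℕ → ℕ
  k ⊟ i = (k + (ℓ ∸ i)) % ℓ

  ≡ₘ-+ʳ : ∀ {a b} c → a ≡ₘ b → a + c ≡ₘ b + c
  ≡ₘ-+ʳ {a} {b} c a≡b = begin
    (a + c) % ℓ               ≡⟨ %-distribˡ-+ a c ℓ ⟩
    (a % ℓ + c % ℓ) % ℓ       ≡⟨ cong (λ x → (x + c % ℓ) % ℓ) a≡b ⟩
    (b % ℓ + c % ℓ) % ℓ       ≡⟨ %-distribˡ-+ b c ℓ ⟨
    (b + c) % ℓ               ∎
    where open ≡-Reasoning

  ≡ₘ-+ˡ : ∀ {a b} c → a ≡ₘ b → c + a ≡ₘ c + b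
  ≡ₘ-+ˡ {a} {b} c a≡b =
    trans (cong (_% ℓ) (ℕₚ.+-comm c a)) (trans (≡ₘ-+ʳ c a≡b) (cong (_% ℓ) (ℕₚ.+-comm b c)))

  ≡ₘ-cancel-+ʳ : ∀ a b c → a + c ≡ₘ b + c → a ≡ₘ b
  ≡ₘ-cancel-+ʳ a b c a+c≡b+c = begin
    a % ℓ                           ≡⟨ [m+kn]%n≡m%n a c ℓ ⟨
    (a + c * ℓ) % ℓ                 ≡⟨ cong (_% ℓ) (regroup a) ⟩
    (a + c + (ℓ ∸ 1) * c) % ℓ       ≡⟨ ≡ₘ-+ʳ ((ℓ ∸ 1) * c) a+c≡b+c ⟩
    (b + c + (ℓ ∸ 1) * c) % ℓ       ≡⟨ cong (_% ℓ) (regroup b) ⟨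
    (b + c * ℓ) % ℓ                 ≡⟨ [m+kn]%n≡m%n b c ℓ ⟩
    b % ℓ                           ∎
    where
    open ≡-Reasoning
    regroup : ∀ x → x + c * ℓ ≡ x + c + (ℓ ∸ 1) * c
    regroup x = begin
      x + c * ℓ                 ≡⟨ cong (λ y → x + c * y) (ℕₚ.suc-pred ℓ) ⟨
      x + c * suc (ℓ ∸ 1)       ≡⟨ cong (λ y → x + y) (ℕₚ.*-suc c (ℓ ∸ 1)) ⟩
      x + (c + c * (ℓ ∸ 1))     ≡⟨ cong (λ y → x + (c + y)) (ℕₚ.*-comm c (ℓ ∸ 1)) ⟩
      x + (c + (ℓ ∸ 1) * c)     ≡⟨ ℕₚ.+-assoc x c _ ⟨
      x + c + (ℓ ∸ 1) * c       ∎

  ≡ₘ⇒≡ : ∀ {a b} → a < ℓ → b < ℓ → a ≡ₘ b → a ≡ b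
  ≡ₘ⇒≡ a<ℓ b<ℓ a≡b = trans (sym (m<n⇒m%n≡m a<ℓ)) (trans a≡b (m<n⇒m%n≡m b<ℓ))

  ⊟<ℓ : ∀ k i → k ⊟ i < ℓ
  ⊟<ℓ k i = m%n<n (k + (ℓ ∸ i)) ℓ

  ⊟-+-≡ₘ : ∀ k {i} → i ≤ ℓ → k ⊟ i + i ≡ₘ k
  ⊟-+-≡ₘ k {i} i≤ℓ = begin
    (k ⊟ i + i) % ℓ           ≡⟨ ≡ₘ-+ʳ i (m%n%n≡m%n (k + (ℓ ∸ i)) ℓ) ⟩
    (k + (ℓ ∸ i) + i) % ℓ     ≡⟨ cong (_% ℓ) (trans (ℕₚ.+-assoc k _ i) (cong (λ y → k + y) (ℕₚ.m∸n+n≡m i≤ℓ))) ⟩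
    (k + ℓ) % ℓ               ≡⟨ [m+n]%n≡m%n k ℓ ⟩
    k % ℓ                     ∎
    where open ≡-Reasoning

  ⊟-unique : ∀ {x k i} → i ≤ ℓ → x < ℓ → x + i ≡ₘ k → k ⊟ i ≡ x
  ⊟-unique {x} {k} {i} i≤ℓ x<ℓ x+i≡k =
    ≡ₘ⇒≡ (⊟<ℓ k i) x<ℓ (≡ₘ-cancel-+ʳ (k ⊟ i) x i (trans (⊟-+-≡ₘ k i≤ℓ) (sym x+i≡k)))

  ⊟-involutive : ∀ k {i} → i < ℓ → k ⊟ (k ⊟ i) ≡ i
  ⊟-involutive k {i} i<ℓ = ⊟-unique (ℕₚ.<⇒≤ (⊟<ℓ k i)) i<ℓ
    (trans (cong (_% ℓ) (ℕₚ.+-comm i (k ⊟ i))) (⊟-+-≡ₘ k (ℕₚ.<⇒≤ i<ℓ)))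

  %-⊟ : ∀ {i} j → i ≤ ℓ → (i + j) % ℓ ⊟ i ≡ j % ℓ
  %-⊟ {i} j i≤ℓ = ⊟-unique i≤ℓ (m%n<n j ℓ) (begin
    (j % ℓ + i) % ℓ     ≡⟨ ≡ₘ-+ʳ i (m%n%n≡m%n j ℓ) ⟩
    (j + i) % ℓ         ≡⟨ cong (_% ℓ) (ℕₚ.+-comm j i) ⟩
    (i + j) % ℓ         ≡⟨ m%n%n≡m%n (i + j) ℓ ⟨
    (i + j) % ℓ % ℓ     ∎)
    where open ≡-Reasoning

  ⊟-%-+ : ∀ k {i j} → i ≤ ℓ → j ≤ ℓ → k ⊟ ((i + j) % ℓ) ≡ k ⊟ i ⊟ j
  ⊟-%-+ k {i} {j} i≤ℓ j≤ℓ = ⊟-unique (ℕₚ.<⇒≤ (m%n<n (i + j) ℓ)) (⊟<ℓ (k ⊟ i) j) (begin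
    (k ⊟ i ⊟ j + (i + j) % ℓ) % ℓ ≡⟨ ≡ₘ-+ˡ (k ⊟ i ⊟ j) (m%n%n≡m%n (i + j) ℓ) ⟩
    (k ⊟ i ⊟ j + (i + j)) % ℓ     ≡⟨ cong (_% ℓ) (trans (cong (λ y → k ⊟ i ⊟ j + y) (ℕₚ.+-comm i j))
                                                         (sym (ℕₚ.+-assoc (k ⊟ i ⊟ j) j i))) ⟩
    (k ⊟ i ⊟ j + j + i) % ℓ       ≡⟨ ≡ₘ-+ʳ i (⊟-+-≡ₘ (k ⊟ i) j≤ℓ) ⟩
    (k ⊟ i + i) % ℓ               ≡⟨ ⊟-+-≡ₘ k i≤ℓ ⟩
    k % ℓ                         ∎)
    where open ≡-Reasoning

  ⊟-neg : ∀ {k i} → k ≤ ℓ → i ≤ ℓ → (0 ⊟ k) ⊟ (0 ⊟ i) ≡ 0 ⊟ (k ⊟ i)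
  ⊟-neg {k} {i} k≤ℓ i≤ℓ = ⊟-unique (ℕₚ.<⇒≤ (⊟<ℓ 0 i)) (⊟<ℓ 0 (k ⊟ i)) (≡ₘ-cancel-+ʳ _ _ k (begin
    (x + 0 ⊟ i + k) % ℓ               ≡⟨ ≡ₘ-+ˡ (x + 0 ⊟ i) (⊟-+-≡ₘ k i≤ℓ) ⟨
    (x + 0 ⊟ i + (k ⊟ i + i)) % ℓ     ≡⟨ cong (_% ℓ) (+-interchange x (0 ⊟ i) (k ⊟ i) i) ⟩
    (x + k ⊟ i + (0 ⊟ i + i)) % ℓ     ≡⟨ ≡ₘ-+ʳ (0 ⊟ i + i) (⊟-+-≡ₘ 0 (ℕₚ.<⇒≤ (⊟<ℓ k i))) ⟩
    (0 ⊟ i + i) % ℓ                   ≡⟨ ⊟-+-≡ₘ 0 i≤ℓ ⟩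
    0 % ℓ                             ≡⟨ ⊟-+-≡ₘ 0 k≤ℓ ⟨
    (0 ⊟ k + k) % ℓ                   ∎))
    where
    open ≡-Reasoning
    x : ℕ
    x = 0 ⊟ (k ⊟ i)

  Σ<-rotate : ∀ s (g : ℕ → ℚ) → Σ< ℓ (λ j → g ((s + j) % ℓ)) ≡ Σ< ℓ g
  Σ<-rotate s g = trans (Σ<-cong ℓ (λ j → cong g (sym (≡ₘ-+ʳ j (m%n%n≡m%n s ℓ)))))
                        (rotate-by (s % ℓ) (m%n<n s ℓ))
    where
    rotate-by : ∀ r → r < ℓ → Σ< ℓ (λ j → g ((r + j) % ℓ)) ≡ Σ< ℓ g
    rotate-by r r<ℓ = begin
      Σ< ℓ G                                      ≡⟨ cong (λ n → Σ< n G) t+r≡ℓ ⟨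
      Σ< (t + r) G                                ≡⟨ Σ<-+ t r G ⟩
      Σ< t G ℚ.+ Σ< r (λ j → G (t + j))           ≡⟨ cong₂ ℚ._+_ (Σ<-cong-< t (λ j j<t → cong g (m<n⇒m%n≡m (r+j<ℓ j<t))))
                                                                 (Σ<-cong-< r (λ j j<r → cong g (wrap j<r))) ⟩
      Σ< t (λ j → g (r + j)) ℚ.+ Σ< r g           ≡⟨ ℚₚ.+-comm _ (Σ< r g) ⟩
      Σ< r g ℚ.+ Σ< t (λ j → g (r + j))           ≡⟨ Σ<-+ r t g ⟨
      Σ< (r + t) g                                ≡⟨ cong (λ n → Σ< n g) r+t≡ℓ ⟩
      Σ< ℓ g                                      ∎
      where
      open ≡-Reasoning
      G : ℕ → ℚ
      G j = g ((r + j) % ℓ)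
      t : ℕ
      t = ℓ ∸ r
      r+t≡ℓ : r + t ≡ ℓ
      r+t≡ℓ = ℕₚ.m+[n∸m]≡n (ℕₚ.<⇒≤ r<ℓ)
      t+r≡ℓ : t + r ≡ ℓ
      t+r≡ℓ = trans (ℕₚ.+-comm t r) r+t≡ℓ
      r+j<ℓ : ∀ {j} → j < t → r + j < ℓ
      r+j<ℓ j<t = subst (_ <_) r+t≡ℓ (ℕₚ.+-monoʳ-< r j<t)
      wrap : ∀ {j} → j < r → (r + (t + j)) % ℓ ≡ j
      wrap {j} j<r = begin
        (r + (t + j)) % ℓ   ≡⟨ cong (_% ℓ) (trans (sym (ℕₚ.+-assoc r t j)) (trans (cong (_+ j) r+t≡ℓ) (ℕₚ.+-comm ℓ j))) ⟩
        (j + ℓ) % ℓ         ≡⟨ [m+n]%n≡m%n j ℓ ⟩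
        j % ℓ               ≡⟨ m<n⇒m%n≡m (ℕₚ.<-trans j<r r<ℓ) ⟩
        j                   ∎

  Σ<-⊟ : ∀ k (g : ℕ → ℚ) → Σ< ℓ (λ i → g (k ⊟ i)) ≡ Σ< ℓ g
  Σ<-⊟ k g = begin
    Σ< ℓ (λ i → g (k ⊟ i))                    ≡⟨ Σ<-cong-< ℓ (λ i i<ℓ → cong (λ x → g (x % ℓ))
                                                   (trans (cong (λ y → k + y) (ℕₚ.+-∸-assoc 1 i<ℓ)) (ℕₚ.+-suc k (ℓ ∸ suc i)))) ⟩
    Σ< ℓ (λ i → g ((suc k + (ℓ ∸ suc i)) % ℓ)) ≡⟨ Σ<-reverse ℓ (λ x → g ((suc k + x) % ℓ)) ⟩
    Σ< ℓ (λ x → g ((suc k + x) % ℓ))           ≡⟨ Σ<-rotate (suc k) g ⟩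
    Σ< ℓ g                                     ∎
    where open ≡-Reasoning

module GroupAlgebra (ℓ : ℕ) .{{_ : NonZero ℓ}} where

  open Cyclotomic ℓ
  open IndexArithmetic ℓ

  ζ^-≡1 : ∀ j k → k ≡ j % ℓ → ζ^ j k ≡ 1ℚ
  ζ^-≡1 j k k≡j with k ≟ j % ℓ
  ... | yes _   = refl
  ... | no k≢j = contradiction k≡j k≢j

  ζ^-≡0 : ∀ j k → k ≢ j % ℓ → ζ^ j k ≡ 0ℚ
  ζ^-≡0 j k k≢j with k ≟ j % ℓ
  ... | yes k≡j = contradiction k≡j k≢j
  ... | no _    = refl

  ζ^-cong-⇔ : ∀ {j k j′ k′} → (k ≡ j % ℓ → k′ ≡ j′ % ℓ) → (k′ ≡ j′ % ℓ → k ≡ j % ℓ) →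
              ζ^ j k ≡ ζ^ j′ k′
  ζ^-cong-⇔ {j} {k} {j′} {k′} to from with k ≟ j % ℓ
  ... | yes k≡j = sym (ζ^-≡1 j′ k′ (to k≡j))
  ... | no k≢j  = sym (ζ^-≡0 j′ k′ (λ k′≡j′ → k≢j (from k′≡j′)))

  ζ^-≡ₘ : ∀ {j j′} k → j ≡ₘ j′ → ζ^ j k ≡ ζ^ j′ k
  ζ^-≡ₘ k j≡j′ = ζ^-cong-⇔ {k = k} {k′ = k} (λ k≡j → trans k≡j j≡j′) (λ k≡j′ → trans k≡j′ (sym j≡j′))

  ζ^-⊗ : ∀ j a k → (ζ^ j ⊗ a) k ≡ a (k ⊟ (j % ℓ))
  ζ^-⊗ j a k = begin
    Σ< ℓ (λ i → ζ^ j i ℚ.* a (k ⊟ i))   ≡⟨ Σ<-single ℓ (j % ℓ) (m%n<n j ℓ) (λ i _ i≢j →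
                                              trans (cong (ℚ._* a (k ⊟ i)) (ζ^-≡0 j i i≢j)) (ℚₚ.*-zeroˡ (a (k ⊟ i)))) ⟩
    ζ^ j (j % ℓ) ℚ.* a (k ⊟ (j % ℓ))      ≡⟨ cong (ℚ._* a (k ⊟ (j % ℓ))) (ζ^-≡1 j (j % ℓ) refl) ⟩
    1ℚ ℚ.* a (k ⊟ (j % ℓ))                ≡⟨ ℚₚ.*-identityˡ _ ⟩
    a (k ⊟ (j % ℓ))                       ∎
    where open ≡-Reasoning

  infix 4 _≐_
  _≐_ : K → K → Set
  a ≐ b = ∀ k → k < ℓ → a k ≡ b k

  ⊗-comm : ∀ a b → a ⊗ b ≐ b ⊗ a
  ⊗-comm a b k _ = trans (sym (Σ<-⊟ k (λ i → a i ℚ.* b (k ⊟ i)))) (Σ<-cong-< ℓ (λ i i<ℓ →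
    trans (cong (λ x → a (k ⊟ i) ℚ.* b x) (⊟-involutive k i<ℓ)) (ℚₚ.*-comm (a (k ⊟ i)) (b i))))

  ⊗-assoc : ∀ a b c → (a ⊗ b) ⊗ c ≐ a ⊗ (b ⊗ c)
  ⊗-assoc a b c k _ = begin
    Σ< ℓ (λ m → Σ< ℓ (λ i → a i ℚ.* b (m ⊟ i)) ℚ.* c (k ⊟ m))
      ≡⟨ Σ<-cong ℓ (λ m → sym (Σ<-distribʳ-* ℓ (c (k ⊟ m)) (λ i → a i ℚ.* b (m ⊟ i)))) ⟩
    Σ< ℓ (λ m → Σ< ℓ (λ i → a i ℚ.* b (m ⊟ i) ℚ.* c (k ⊟ m)))
      ≡⟨ Σ<-comm ℓ ℓ _ ⟩
    Σ< ℓ (λ i → Σ< ℓ (λ m → a i ℚ.* b (m ⊟ i) ℚ.* c (k ⊟ m)))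
      ≡⟨ Σ<-cong ℓ (λ i → trans (Σ<-cong ℓ (λ m → ℚₚ.*-assoc (a i) _ _)) (Σ<-distribˡ-* ℓ (a i) _)) ⟩
    Σ< ℓ (λ i → a i ℚ.* Σ< ℓ (λ m → b (m ⊟ i) ℚ.* c (k ⊟ m)))
      ≡⟨ Σ<-cong-< ℓ (λ i i<ℓ → cong (a i ℚ.*_) (inner i<ℓ)) ⟩
    Σ< ℓ (λ i → a i ℚ.* (b ⊗ c) (k ⊟ i)) ∎
    where
    open ≡-Reasoning
    inner : ∀ {i} → i < ℓ → Σ< ℓ (λ m → b (m ⊟ i) ℚ.* c (k ⊟ m)) ≡ (b ⊗ c) (k ⊟ i)
    inner {i} i<ℓ = trans (sym (Σ<-rotate i (λ m → b (m ⊟ i) ℚ.* c (k ⊟ m)))) (Σ<-cong-< ℓ (λ j j<ℓ →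
      cong₂ ℚ._*_ (cong b (trans (%-⊟ j (ℕₚ.<⇒≤ i<ℓ)) (m<n⇒m%n≡m j<ℓ)))
                  (cong c (⊟-%-+ k (ℕₚ.<⇒≤ i<ℓ) (ℕₚ.<⇒≤ j<ℓ)))))

  ⊗-identityˡ : ∀ a → one ⊗ a ≐ a
  ⊗-identityˡ a k k<ℓ = trans (ζ^-⊗ 0 a k) (cong a (begin
    k ⊟ (0 % ℓ)        ≡⟨ cong (k ⊟_) (m<n⇒m%n≡m 0<ℓ) ⟩
    (k + ℓ) % ℓ        ≡⟨ [m+n]%n≡m%n k ℓ ⟩
    k % ℓ              ≡⟨ m<n⇒m%n≡m k<ℓ ⟩
    k                  ∎))
    where open ≡-Reasoning

  ζ^-+ : ∀ a b → ζ^ a ⊗ ζ^ b ≐ ζ^ (a + b)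
  ζ^-+ a b k k<ℓ = trans (ζ^-⊗ a (ζ^ b) k) (ζ^-cong-⇔ to from)
    where
    open ≡-Reasoning
    r : ℕ
    r = a % ℓ
    r≤ℓ : r ≤ ℓ
    r≤ℓ = ℕₚ.<⇒≤ (m%n<n a ℓ)
    to : k ⊟ r ≡ b % ℓ → k ≡ (a + b) % ℓ
    to k⊟r≡b = begin
      k                   ≡⟨ m<n⇒m%n≡m k<ℓ ⟨
      k % ℓ               ≡⟨ ⊟-+-≡ₘ k r≤ℓ ⟨
      (k ⊟ r + r) % ℓ     ≡⟨ cong (λ x → (x + r) % ℓ) k⊟r≡b ⟩
      (b % ℓ + r) % ℓ     ≡⟨ ≡ₘ-+ʳ r (m%n%n≡m%n b ℓ) ⟩
      (b + r) % ℓ         ≡⟨ ≡ₘ-+ˡ b (m%n%n≡m%n a ℓ) ⟩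
      (b + a) % ℓ         ≡⟨ cong (_% ℓ) (ℕₚ.+-comm b a) ⟩
      (a + b) % ℓ         ∎
    from : k ≡ (a + b) % ℓ → k ⊟ r ≡ b % ℓ
    from k≡a+b = begin
      k ⊟ r               ≡⟨ cong (_⊟ r) (trans k≡a+b (sym (≡ₘ-+ʳ b (m%n%n≡m%n a ℓ)))) ⟩
      (r + b) % ℓ ⊟ r     ≡⟨ %-⊟ b r≤ℓ ⟩
      b % ℓ               ∎

  conj-⊗ : ∀ a b → conj (a ⊗ b) ≐ conj a ⊗ conj b
  conj-⊗ a b k k<ℓ = trans (sym (Σ<-⊟ 0 (λ i → a i ℚ.* b (0 ⊟ k ⊟ i)))) (Σ<-cong-< ℓ (λ i i<ℓ →
    cong (λ x → a (0 ⊟ i) ℚ.* b x) (⊟-neg (ℕₚ.<⇒≤ k<ℓ) (ℕₚ.<⇒≤ i<ℓ))))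

  conj-ζ^ : ∀ j → conj (ζ^ j) ≐ ζ^ (ℓ ∸ j % ℓ)
  conj-ζ^ j k k<ℓ = ζ^-cong-⇔
    (λ 0⊟k≡j → trans (sym (⊟-involutive 0 k<ℓ)) (cong (0 ⊟_) 0⊟k≡j))
    (λ k≡0⊟j → trans (cong (0 ⊟_) k≡0⊟j) (⊟-involutive 0 (m%n<n j ℓ)))

  ⊗-distribˡ-⊕ : ∀ a b c → a ⊗ (b ⊕ c) ≐ (a ⊗ b) ⊕ (a ⊗ c)
  ⊗-distribˡ-⊕ a b c k _ = trans (Σ<-cong ℓ (λ i → ℚₚ.*-distribˡ-+ (a i) _ _)) (Σ<-distrib-+ ℓ _ _)

  ⊗-distribʳ-⊕ : ∀ a b c → (a ⊕ b) ⊗ c ≐ (a ⊗ c) ⊕ (b ⊗ c)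
  ⊗-distribʳ-⊕ a b c k _ = trans (Σ<-cong ℓ (λ i → ℚₚ.*-distribʳ-+ (c (k ⊟ i)) (a i) _)) (Σ<-distrib-+ ℓ _ _)

  ⊗-distribˡ-⊖ : ∀ a b c → a ⊗ (b ⊖ c) ≐ (a ⊗ b) ⊖ (a ⊗ c)
  ⊗-distribˡ-⊖ a b c k _ = trans (Σ<-cong ℓ (λ i →
    solve 3 (λ x y z → x :* (y :- z) := x :* y :- x :* z) refl (a i) (b (k ⊟ i)) (c (k ⊟ i)))) (Σ<-distrib-- ℓ _ _)

  ⊗-distribʳ-⊖ : ∀ a b c → (a ⊖ b) ⊗ c ≐ (a ⊗ c) ⊖ (b ⊗ c)
  ⊗-distribʳ-⊖ a b c k _ = trans (Σ<-cong ℓ (λ i →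
    solve 3 (λ x y z → (x :- y) :* z := x :* z :- y :* z) refl (a i) (b i) (c (k ⊟ i)))) (Σ<-distrib-- ℓ _ _)

  ·-⊗ : ∀ s a b → (s · a) ⊗ b ≐ s · (a ⊗ b)
  ·-⊗ s a b k _ = trans (Σ<-cong ℓ (λ i → ℚₚ.*-assoc s (a i) _)) (Σ<-distribˡ-* ℓ s _)

  ⊗-· : ∀ s a b → a ⊗ (s · b) ≐ s · (a ⊗ b)
  ⊗-· s a b k _ = trans (Σ<-cong ℓ (λ i →
    solve 3 (λ x y z → x :* (y :* z) := y :* (x :* z)) refl (a i) s (b (k ⊟ i)))) (Σ<-distribˡ-* ℓ s _)

  -- A record rather than _≈_ itself, so that a and b can be inferred from a proof of a ∼ b.
  infix 4 _∼_
  record _∼_ (a b : K) : Set where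
    constructor mk∼
    field un∼ : a ≈ b

  shift⇒∼ : ∀ {a b} c → (∀ k → k < ℓ → a k ≡ b k ℚ.+ c) → a ∼ b
  shift⇒∼ {a} {b} c a≡b+c = mk∼ λ i j i<ℓ j<ℓ → trans (a-b≡c i<ℓ) (sym (a-b≡c j<ℓ))
    where
    a-b≡c : ∀ {k} → k < ℓ → a k ℚ.- b k ≡ c
    a-b≡c {k} k<ℓ = trans (cong (ℚ._- b k) (a≡b+c k k<ℓ)) (solve 2 (λ x y → (x :+ y) :- x := y) refl (b k) c)

  ∼⇒shift : ∀ {a b} → a ∼ b → Σ ℚ λ c → ∀ k → k < ℓ → a k ≡ b k ℚ.+ c
  ∼⇒shift {a} {b} (mk∼ a≈b) = a 0 ℚ.- b 0 , λ k k<ℓ →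
    trans (solve 2 (λ x y → x := y :+ (x :- y)) refl (a k) (b k)) (cong (b k ℚ.+_) (a≈b k 0 k<ℓ 0<ℓ))

  ≐⇒∼ : ∀ {a b} → a ≐ b → a ∼ b
  ≐⇒∼ {a} {b} a≐b = shift⇒∼ 0ℚ (λ k k<ℓ → trans (a≐b k k<ℓ) (sym (ℚₚ.+-identityʳ (b k))))

  ∼-refl : ∀ {a} → a ∼ a
  ∼-refl = ≐⇒∼ (λ _ _ → refl)

  ∼-sym : ∀ {a b} → a ∼ b → b ∼ a
  ∼-sym {a} {b} a∼b =
    let c , a≡b+c = ∼⇒shift a∼b in
    shift⇒∼ (ℚ.- c) λ k k<ℓ → trans (solve 2 (λ x y → x := (x :+ y) :+ (:- y)) refl (b k) c)
                                    (cong (λ x → x ℚ.+ ℚ.- c) (sym (a≡b+c k k<ℓ)))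

  ∼-trans : ∀ {a b c} → a ∼ b → b ∼ c → a ∼ c
  ∼-trans {a} {b} {c} a∼b b∼c =
    let s , a≡b+s = ∼⇒shift a∼b
        t , b≡c+t = ∼⇒shift b∼c in
    shift⇒∼ (t ℚ.+ s) λ k k<ℓ →
      trans (a≡b+s k k<ℓ) (trans (cong (ℚ._+ s) (b≡c+t k k<ℓ)) (ℚₚ.+-assoc (c k) t s))

  ⊕-cong : ∀ {a a′ b b′} → a ∼ a′ → b ∼ b′ → a ⊕ b ∼ a′ ⊕ b′
  ⊕-cong {a} {a′} {b} {b′} a∼a′ b∼b′ =
    let s , a≡a′+s = ∼⇒shift a∼a′
        t , b≡b′+t = ∼⇒shift b∼b′ in
    shift⇒∼ (s ℚ.+ t) λ k k<ℓ →
      trans (cong₂ ℚ._+_ (a≡a′+s k k<ℓ) (b≡b′+t k k<ℓ))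
            (solve 4 (λ x y u v → (x :+ u) :+ (y :+ v) := (x :+ y) :+ (u :+ v)) refl (a′ k) (b′ k) s t)

  ⊖-cong : ∀ {a a′ b b′} → a ∼ a′ → b ∼ b′ → a ⊖ b ∼ a′ ⊖ b′
  ⊖-cong {a} {a′} {b} {b′} a∼a′ b∼b′ =
    let s , a≡a′+s = ∼⇒shift a∼a′
        t , b≡b′+t = ∼⇒shift b∼b′ in
    shift⇒∼ (s ℚ.- t) λ k k<ℓ →
      trans (cong₂ ℚ._-_ (a≡a′+s k k<ℓ) (b≡b′+t k k<ℓ))
            (solve 4 (λ x y u v → (x :+ u) :- (y :+ v) := (x :- y) :+ (u :- v)) refl (a′ k) (b′ k) s t)

  ·-congˡ : ∀ r {a a′} → a ∼ a′ → r · a ∼ r · a′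
  ·-congˡ r {a} {a′} a∼a′ =
    let s , a≡a′+s = ∼⇒shift a∼a′ in
    shift⇒∼ (r ℚ.* s) λ k k<ℓ → trans (cong (r ℚ.*_) (a≡a′+s k k<ℓ)) (ℚₚ.*-distribˡ-+ r (a′ k) s)

  conj-cong : ∀ {a a′} → a ∼ a′ → conj a ∼ conj a′
  conj-cong a∼a′ =
    let s , a≡a′+s = ∼⇒shift a∼a′ in
    shift⇒∼ s λ k _ → a≡a′+s (0 ⊟ k) (⊟<ℓ 0 k)

  ⊗-congˡ : ∀ a {b b′} → b ∼ b′ → a ⊗ b ∼ a ⊗ b′
  ⊗-congˡ a {b} {b′} b∼b′ =
    let s , b≡b′+s = ∼⇒shift b∼b′ in
    shift⇒∼ (Σ< ℓ a ℚ.* s) λ k k<ℓ → begin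
      Σ< ℓ (λ i → a i ℚ.* b (k ⊟ i))               ≡⟨ Σ<-cong ℓ (λ i → trans (cong (a i ℚ.*_) (b≡b′+s (k ⊟ i) (⊟<ℓ k i)))
                                                                         (ℚₚ.*-distribˡ-+ (a i) _ s)) ⟩
      Σ< ℓ (λ i → a i ℚ.* b′ (k ⊟ i) ℚ.+ a i ℚ.* s) ≡⟨ Σ<-distrib-+ ℓ _ _ ⟩
      (a ⊗ b′) k ℚ.+ Σ< ℓ (λ i → a i ℚ.* s)         ≡⟨ cong ((a ⊗ b′) k ℚ.+_) (Σ<-distribʳ-* ℓ s a) ⟩
      (a ⊗ b′) k ℚ.+ Σ< ℓ a ℚ.* s                   ∎
    where open ≡-Reasoning

  ⊗-cong : ∀ {a a′ b b′} → a ∼ a′ → b ∼ b′ → a ⊗ b ∼ a′ ⊗ b′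
  ⊗-cong {a} {a′} {b} {b′} a∼a′ b∼b′ = ∼-trans (⊗-congˡ a b∼b′) (∼-trans (≐⇒∼ (⊗-comm a b′))
    (∼-trans (⊗-congˡ b′ a∼a′) (≐⇒∼ (⊗-comm b′ a′))))

  ⊗-congʳ : ∀ {a a′} b → a ∼ a′ → a ⊗ b ∼ a′ ⊗ b
  ⊗-congʳ b a∼a′ = ⊗-cong a∼a′ (∼-refl {b})

  ⊗-commutativeMonoid : CommutativeMonoid 0ℓ 0ℓ
  ⊗-commutativeMonoid = record
    { Carrier             = K
    ; _≈_                 = _∼_
    ; _∙_                 = _⊗_
    ; ε                   = one
    ; isCommutativeMonoid = record
      { isMonoid = record
        { isSemigroup = record
          { isMagma = record
            { isEquivalence = record { refl = ∼-refl ; sym = ∼-sym ; trans = ∼-trans }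
            ; ∙-cong        = ⊗-cong
            }
          ; assoc = λ a b c → ≐⇒∼ (⊗-assoc a b c)
          }
        ; identity = (λ a → ≐⇒∼ (⊗-identityˡ a))
                   , (λ a → ∼-trans (≐⇒∼ (⊗-comm a one)) (≐⇒∼ (⊗-identityˡ a)))
        }
      ; comm = λ a b → ≐⇒∼ (⊗-comm a b)
      }
    }

  trζ^-0 : trζ^ 0 ≡ ℕ→ℚ (ℓ ∸ 1)
  trζ^-0 with 0 % ℓ ≟ 0
  ... | yes _   = refl
  ... | no 0≢0 = contradiction (m<n⇒m%n≡m 0<ℓ) 0≢0

  trζ^-suc : ∀ i → suc i < ℓ → trζ^ (suc i) ≡ ℚ.- 1ℚ
  trζ^-suc i 1+i<ℓ with suc i % ℓ ≟ 0
  ... | yes 1+i≡0 = contradiction (trans (sym (m<n⇒m%n≡m 1+i<ℓ)) 1+i≡0) ℕₚ.1+n≢0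
  ... | no _      = refl

  Σ<-trζ^ : Σ< ℓ trζ^ ≡ 0ℚ
  Σ<-trζ^ = begin
    Σ< ℓ trζ^                                  ≡⟨ cong (λ n → Σ< n trζ^) (ℕₚ.suc-pred ℓ) ⟨
    Σ< (suc n) trζ^                            ≡⟨ Σ<-suc n trζ^ ⟩
    trζ^ 0 ℚ.+ Σ< n (λ i → trζ^ (suc i))       ≡⟨ cong₂ ℚ._+_ trζ^-0 (Σ<-cong-< n (λ i i<n →
                                                    trζ^-suc i (subst (suc i <_) (ℕₚ.suc-pred ℓ) (s≤s i<n)))) ⟩
    ℕ→ℚ n ℚ.+ Σ< n (λ _ → ℚ.- 1ℚ)              ≡⟨ cong (ℕ→ℚ n ℚ.+_) (Σ<-const n (ℚ.- 1ℚ)) ⟩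
    ℕ→ℚ n ℚ.+ ℕ→ℚ n ℚ.* (ℚ.- 1ℚ)               ≡⟨ solve 1 (λ x → x :+ x :* (:- con 1ℚ) := con 0ℚ) refl (ℕ→ℚ n) ⟩
    0ℚ                                         ∎
    where
    open ≡-Reasoning
    n : ℕ
    n = ℓ ∸ 1

  tr-· : ∀ s a → tr (s · a) ≡ s ℚ.* tr a
  tr-· s a = trans (Σ<-cong ℓ (λ k → ℚₚ.*-assoc s (a k) (trζ^ k))) (Σ<-distribˡ-* ℓ s _)

  tr-cong : ∀ {a b} → a ∼ b → tr a ≡ tr b
  tr-cong {a} {b} a∼b =
    let s , a≡b+s = ∼⇒shift a∼b in begin
    tr a                                          ≡⟨ Σ<-cong-< ℓ (λ k k<ℓ → trans (cong (ℚ._* trζ^ k) (a≡b+s k k<ℓ))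
                                                                                (ℚₚ.*-distribʳ-+ (trζ^ k) (b k) s)) ⟩
    Σ< ℓ (λ k → b k ℚ.* trζ^ k ℚ.+ s ℚ.* trζ^ k) ≡⟨ Σ<-distrib-+ ℓ _ _ ⟩
    tr b ℚ.+ Σ< ℓ (λ k → s ℚ.* trζ^ k)            ≡⟨ cong (tr b ℚ.+_) (Σ<-distribˡ-* ℓ s trζ^) ⟩
    tr b ℚ.+ s ℚ.* Σ< ℓ trζ^                      ≡⟨ cong (λ x → tr b ℚ.+ s ℚ.* x) Σ<-trζ^ ⟩
    tr b ℚ.+ s ℚ.* 0ℚ                             ≡⟨ cong (tr b ℚ.+_) (ℚₚ.*-zeroʳ s) ⟩
    tr b ℚ.+ 0ℚ                                   ≡⟨ ℚₚ.+-identityʳ (tr b) ⟩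
    tr b                                          ∎
    where open ≡-Reasoning

  open CommutativeMonoid ⊗-commutativeMonoid public
    using (assoc; identityˡ; identityʳ; comm)
  open CommutativeSemigroupProperties (CommutativeMonoid.commutativeSemigroup ⊗-commutativeMonoid) public
    using (interchange; x∙yz≈y∙xz)
  module ∼-Reasoning = SetoidReasoning (CommutativeMonoid.setoid ⊗-commutativeMonoid)

  ^-cong : ∀ n {a b} → a ∼ b → a ^^ n ∼ b ^^ n
  ^-cong zero    _   = ∼-refl
  ^-cong (suc n) a∼b = ⊗-cong a∼b (^-cong n a∼b)

  ^-distribʳ-⊗ : ∀ a b n → (a ⊗ b) ^^ n ∼ (a ^^ n) ⊗ (b ^^ n)
  ^-distribʳ-⊗ a b zero    = ∼-sym (identityˡ one)
  ^-distribʳ-⊗ a b (suc n) = ∼-trans (⊗-congˡ (a ⊗ b) (^-distribʳ-⊗ a b n)) (interchange a b (a ^^ n) (b ^^ n))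

  ^-homo-+ : ∀ a m n → a ^^ (m + n) ∼ (a ^^ m) ⊗ (a ^^ n)
  ^-homo-+ a zero    n = ∼-sym (identityˡ (a ^^ n))
  ^-homo-+ a (suc m) n = ∼-trans (⊗-congˡ a (^-homo-+ a m n)) (∼-sym (assoc a (a ^^ m) (a ^^ n)))

  one-^ : ∀ n → one ^^ n ∼ one
  one-^ zero    = ∼-refl
  one-^ (suc n) = ∼-trans (identityˡ (one ^^ n)) (one-^ n)

  -- the exponent is written m * 2, so that suc m * 2 reduces to suc (suc (m * 2))
  neg-^-even : ∀ a m → ((ℚ.- 1ℚ) · a) ^^ (m * 2) ∼ a ^^ (m * 2)
  neg-^-even a zero    = ∼-refl
  neg-^-even a (suc m) = begin
    −a ⊗ (−a ⊗ (−a ^^ (m * 2)))        ≈⟨ ⊗-congˡ −a (⊗-congˡ −a (neg-^-even a m)) ⟩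
    −a ⊗ (−a ⊗ X)                      ≈⟨ ≐⇒∼ (·-⊗ −1 a (−a ⊗ X)) ⟩
    −1 · (a ⊗ (−a ⊗ X))                ≈⟨ ·-congˡ −1 (⊗-congˡ a (≐⇒∼ (·-⊗ −1 a X))) ⟩
    −1 · (a ⊗ (−1 · (a ⊗ X)))          ≈⟨ ·-congˡ −1 (≐⇒∼ (⊗-· −1 a (a ⊗ X))) ⟩
    −1 · (−1 · (a ⊗ (a ⊗ X)))          ≈⟨ ≐⇒∼ (λ k _ → solve 1 (λ x → con −1 :* (con −1 :* x) := x) refl ((a ⊗ (a ⊗ X)) k)) ⟩
    a ⊗ (a ⊗ X)                        ∎
    where
    open ∼-Reasoning
    −1 : ℚ
    −1 = ℚ.- 1ℚ
    −a X : K
    −a = −1 · a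
    X = a ^^ (m * 2)

  conj-one : conj one ∼ one
  conj-one = ≐⇒∼ λ k k<ℓ → trans (conj-ζ^ 0 k k<ℓ) (ζ^-≡ₘ k (begin
    (ℓ ∸ 0 % ℓ) % ℓ    ≡⟨ cong (λ x → (ℓ ∸ x) % ℓ) (m<n⇒m%n≡m 0<ℓ) ⟩
    ℓ % ℓ              ≡⟨ n%n≡0 ℓ ⟩
    0                  ≡⟨ m<n⇒m%n≡m 0<ℓ ⟨
    0 % ℓ              ∎))
    where open ≡-Reasoning

  conj-^ : ∀ a n → conj (a ^^ n) ∼ (conj a) ^^ n
  conj-^ a zero    = conj-one
  conj-^ a (suc n) = ∼-trans (≐⇒∼ (conj-⊗ a (a ^^ n))) (⊗-congˡ (conj a) (conj-^ a n))

module Integrality (ℓ : ℕ) .{{_ : NonZero ℓ}} where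

  open Cyclotomic ℓ
  open IndexArithmetic ℓ
  open GroupAlgebra ℓ

  IsIntegral : K → Set
  IsIntegral a = Σ (ℕ → ℤ) λ b → a ∼ (λ k → ℤ→ℚ (b k))

  integral-ζ^ : ∀ j → IsIntegral (ζ^ j)
  integral-ζ^ j = coeffs , ≐⇒∼ (λ k _ → ζ^≡coeffs k)
    where
    coeffs : ℕ → ℤ
    coeffs k with k ≟ j % ℓ
    ... | yes _ = + 1
    ... | no  _ = + 0
    ζ^≡coeffs : ∀ k → ζ^ j k ≡ ℤ→ℚ (coeffs k)
    ζ^≡coeffs k with k ≟ j % ℓ
    ... | yes _ = refl
    ... | no  _ = refl

  integral-⊕ : ∀ {a b} → IsIntegral a → IsIntegral b → IsIntegral (a ⊕ b)
  integral-⊕ (ca , a∼ca) (cb , b∼cb) =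
    (λ k → ca k ℤ.+ cb k) , ∼-trans (⊕-cong a∼ca b∼cb) (≐⇒∼ (λ k _ → sym (ℤ→ℚ-homo-+ (ca k) (cb k))))

  integral-⊖ : ∀ {a b} → IsIntegral a → IsIntegral b → IsIntegral (a ⊖ b)
  integral-⊖ (ca , a∼ca) (cb , b∼cb) =
    (λ k → ca k ℤ.- cb k) , ∼-trans (⊖-cong a∼ca b∼cb) (≐⇒∼ (λ k _ → sym (ℤ→ℚ-homo-- (ca k) (cb k))))

  integral-⊗ : ∀ {a b} → IsIntegral a → IsIntegral b → IsIntegral (a ⊗ b)
  integral-⊗ (ca , a∼ca) (cb , b∼cb) = cab , ∼-trans (⊗-cong a∼ca b∼cb) (≐⇒∼ λ k _ → sym (begin
    ℤ→ℚ (cab k)                                        ≡⟨ ℤ→ℚ-homo-Σ< ℓ _ ⟩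
    Σ< ℓ (λ i → ℤ→ℚ (ca i ℤ.* cb (k ⊟ i)))            ≡⟨ Σ<-cong ℓ (λ i → ℤ→ℚ-homo-* (ca i) (cb (k ⊟ i))) ⟩
    Σ< ℓ (λ i → ℤ→ℚ (ca i) ℚ.* ℤ→ℚ (cb (k ⊟ i)))       ∎))
    where
    open ≡-Reasoning
    cab : ℕ → ℤ
    cab k = Σ<ℤ ℓ (λ i → ca i ℤ.* cb (k ⊟ i))

  integral-^ : ∀ {a} → IsIntegral a → ∀ n → IsIntegral (a ^^ n)
  integral-^ a-int zero    = integral-ζ^ 0
  integral-^ a-int (suc n) = integral-⊗ a-int (integral-^ a-int n)

  emb-coeff : ∀ x k → k < ℓ → emb x k ≡ ℤ→ℚ (coeff x k)
  emb-coeff x k k<ℓ = begin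
    ΣFin (ℓ ∸ 1) (λ i → ℤ→ℚ (lookup x i) ℚ.* ζ^ (toℕ i) k)
      ≡⟨ ΣFin-cong (ℓ ∸ 1) (λ i → cong (λ z → ℤ→ℚ z ℚ.* ζ^ (toℕ i) k) (lookup≡coeff x i)) ⟩
    ΣFin (ℓ ∸ 1) (λ i → term (toℕ i))
      ≡⟨ ΣFin-toℕ (ℓ ∸ 1) term ⟩
    Σ< (ℓ ∸ 1) term
      ≡⟨ by-position (k <? ℓ ∸ 1) ⟩
    ℤ→ℚ (coeff x k) ∎
    where
    open ≡-Reasoning
    term : ℕ → ℚ
    term j = ℤ→ℚ (coeff x j) ℚ.* ζ^ j k
    j%ℓ≡j : ∀ {j} → j < ℓ ∸ 1 → j % ℓ ≡ j
    j%ℓ≡j j<ℓ-1 = m<n⇒m%n≡m (ℕₚ.<-trans j<ℓ-1 ℓ-1<ℓ)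
    term-0 : ∀ {j} → j < ℓ ∸ 1 → k ≢ j → term j ≡ 0ℚ
    term-0 {j} j<ℓ-1 k≢j =
      trans (cong (ℤ→ℚ (coeff x j) ℚ.*_) (ζ^-≡0 j k (λ k≡j → k≢j (trans k≡j (j%ℓ≡j j<ℓ-1))))) (ℚₚ.*-zeroʳ (ℤ→ℚ (coeff x j)))
    by-position : Dec (k < ℓ ∸ 1) → Σ< (ℓ ∸ 1) term ≡ ℤ→ℚ (coeff x k)
    by-position (yes k<ℓ-1) = begin
      Σ< (ℓ ∸ 1) term                ≡⟨ Σ<-single (ℓ ∸ 1) k k<ℓ-1 (λ j j<ℓ-1 j≢k → term-0 j<ℓ-1 (λ k≡j → j≢k (sym k≡j))) ⟩
      ℤ→ℚ (coeff x k) ℚ.* ζ^ k k     ≡⟨ cong (ℤ→ℚ (coeff x k) ℚ.*_) (ζ^-≡1 k k (sym (j%ℓ≡j k<ℓ-1))) ⟩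
      ℤ→ℚ (coeff x k) ℚ.* 1ℚ         ≡⟨ ℚₚ.*-identityʳ _ ⟩
      ℤ→ℚ (coeff x k)                ∎
    by-position (no k≮ℓ-1) = begin
      Σ< (ℓ ∸ 1) term                ≡⟨ Σ<-zero (ℓ ∸ 1) (λ j j<ℓ-1 → term-0 j<ℓ-1 (λ k≡j → k≮ℓ-1 (subst (_< ℓ ∸ 1) (sym k≡j) j<ℓ-1))) ⟩
      0ℚ                             ≡⟨ cong ℤ→ℚ (coeff-≥ x k (ℕₚ.≮⇒≥ k≮ℓ-1)) ⟨
      ℤ→ℚ (coeff x k)                ∎

  integral-emb : ∀ x → IsIntegral (emb x)
  integral-emb x = coeff x , ≐⇒∼ (emb-coeff x)

  emb-+ : ∀ x y → emb (x +ℤ[ζ] y) ∼ emb x ⊕ emb y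
  emb-+ x y = ≐⇒∼ λ k k<ℓ → begin
    emb (x +ℤ[ζ] y) k                          ≡⟨ emb-coeff (x +ℤ[ζ] y) k k<ℓ ⟩
    ℤ→ℚ (coeff (x +ℤ[ζ] y) k)                  ≡⟨ cong ℤ→ℚ (coeff-zipWith-+ x y k) ⟩
    ℤ→ℚ (coeff x k ℤ.+ coeff y k)              ≡⟨ ℤ→ℚ-homo-+ (coeff x k) (coeff y k) ⟩
    ℤ→ℚ (coeff x k) ℚ.+ ℤ→ℚ (coeff y k)        ≡⟨ cong₂ ℚ._+_ (emb-coeff x k k<ℓ) (emb-coeff y k k<ℓ) ⟨
    emb x k ℚ.+ emb y k                        ∎
    where open ≡-Reasoning

  emb-top : ∀ x → emb x (ℓ ∸ 1) ≡ 0ℚ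
  emb-top x = trans (emb-coeff x (ℓ ∸ 1) ℓ-1<ℓ) (cong ℤ→ℚ (coeff-≥ x (ℓ ∸ 1) ℕₚ.≤-refl))

  -- by emb-top, the constant by which emb x and emb y differ is 0
  emb-injective : ∀ {x y} → emb x ∼ emb y → x ≡ y
  emb-injective {x} {y} emb-x∼emb-y =
    coeff-injective λ j j<ℓ-1 → ℤ→ℚ-injective (same-coeff (ℕₚ.<-trans j<ℓ-1 ℓ-1<ℓ) (∼⇒shift emb-x∼emb-y))
    where
    open ≡-Reasoning
    same-coeff : ∀ {j} → j < ℓ → (Σ ℚ λ c → ∀ k → k < ℓ → emb x k ≡ emb y k ℚ.+ c) →
                 ℤ→ℚ (coeff x j) ≡ ℤ→ℚ (coeff y j)
    same-coeff {j} j<ℓ (c , emb-x≡emb-y+c) = begin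
      ℤ→ℚ (coeff x j)    ≡⟨ emb-coeff x j j<ℓ ⟨
      emb x j            ≡⟨ emb-x≡emb-y+c j j<ℓ ⟩
      emb y j ℚ.+ c      ≡⟨ cong (emb y j ℚ.+_) c≡0 ⟩
      emb y j ℚ.+ 0ℚ     ≡⟨ ℚₚ.+-identityʳ (emb y j) ⟩
      emb y j            ≡⟨ emb-coeff y j j<ℓ ⟩
      ℤ→ℚ (coeff y j)    ∎
      where
      c≡0 : c ≡ 0ℚ
      c≡0 = begin
        c                        ≡⟨ ℚₚ.+-identityˡ c ⟨
        0ℚ ℚ.+ c                 ≡⟨ cong (ℚ._+ c) (emb-top y) ⟨
        emb y (ℓ ∸ 1) ℚ.+ c      ≡⟨ emb-x≡emb-y+c (ℓ ∸ 1) ℓ-1<ℓ ⟨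
        emb x (ℓ ∸ 1)            ≡⟨ emb-top x ⟩
        0ℚ                       ∎

  -- subtracting b (ℓ-1) from every coefficient kills the ζ^(ℓ-1) term without changing the class
  toBasis : (ℕ → ℤ) → ℤ[ζ]
  toBasis b = tabulate (λ i → b (toℕ i) ℤ.- b (ℓ ∸ 1))

  emb-toBasis : ∀ b → emb (toBasis b) ∼ (λ k → ℤ→ℚ (b k))
  emb-toBasis b = shift⇒∼ (ℚ.- ℤ→ℚ (b (ℓ ∸ 1))) λ k k<ℓ →
    trans (emb-coeff (toBasis b) k k<ℓ) (trans (by-position k<ℓ (k <? ℓ ∸ 1)) (ℤ→ℚ-homo-- (b k) (b (ℓ ∸ 1))))
    where
    by-position : ∀ {k} → k < ℓ → Dec (k < ℓ ∸ 1) → ℤ→ℚ (coeff (toBasis b) k) ≡ ℤ→ℚ (b k ℤ.- b (ℓ ∸ 1))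
    by-position {k} _ (yes k<ℓ-1) =
      cong ℤ→ℚ (trans (coeff-tabulate _ k k<ℓ-1) (cong (λ j → b j ℤ.- b (ℓ ∸ 1)) (Finₚ.toℕ-fromℕ< k<ℓ-1)))
    by-position {k} k<ℓ (no k≮ℓ-1) = begin
      ℤ→ℚ (coeff (toBasis b) k)           ≡⟨ cong ℤ→ℚ (coeff-≥ (toBasis b) k (ℕₚ.≮⇒≥ k≮ℓ-1)) ⟩
      0ℚ                                  ≡⟨ cong ℤ→ℚ (ℤₚ.+-inverseʳ (b (ℓ ∸ 1))) ⟨
      ℤ→ℚ (b (ℓ ∸ 1) ℤ.- b (ℓ ∸ 1))       ≡⟨ cong (λ j → ℤ→ℚ (b j ℤ.- b (ℓ ∸ 1))) k≡ℓ-1 ⟨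
      ℤ→ℚ (b k ℤ.- b (ℓ ∸ 1))             ∎
      where
      open ≡-Reasoning
      k≡ℓ-1 : k ≡ ℓ ∸ 1
      k≡ℓ-1 = ℕₚ.≤-antisym (ℕₚ.≤-pred (subst (k <_) (sym (ℕₚ.suc-pred ℓ)) k<ℓ)) (ℕₚ.≮⇒≥ k≮ℓ-1)

  integral⇒emb : ∀ {a} → IsIntegral a → Σ ℤ[ζ] λ x → emb x ∼ a
  integral⇒emb (b , a∼b) = toBasis b , ∼-trans (emb-toBasis b) (∼-sym a∼b)

module MultiplicationByGenerator (ℓ : ℕ) .{{_ : NonZero ℓ}} where

  open Cyclotomic ℓ
  open GroupAlgebra ℓ
  open Integrality ℓ

  module _
    (k : ℕ) (γ : K) (γ-integral : IsIntegral γ)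
    (γ⁻¹ : K) (γ⁻¹⊗γ : γ⁻¹ ⊗ γ ∼ one)
    (u : K) (u-integral : IsIntegral u) (γ-factor : γ ∼ ((one ⊖ ζ^ 1) ^^ k) ⊗ u)
    (v : K) (v-integral : IsIntegral v) (γ⊗v : γ ⊗ v ∼ (one ⊖ ζ^ 1) ^^ k)
    where

    [1-ζ]^k : K
    [1-ζ]^k = (one ⊖ ζ^ 1) ^^ k

    mul : ℤ[ζ] → ℤ[ζ]
    mul x = proj₁ (integral⇒emb (integral-⊗ γ-integral (integral-emb x)))

    emb-mul : ∀ x → emb (mul x) ∼ γ ⊗ emb x
    emb-mul x = proj₂ (integral⇒emb (integral-⊗ γ-integral (integral-emb x)))

    mul-+ : ∀ x y → mul (x +ℤ[ζ] y) ≡ mul x +ℤ[ζ] mul y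
    mul-+ x y = emb-injective (begin
      emb (mul (x +ℤ[ζ] y))          ≈⟨ emb-mul (x +ℤ[ζ] y) ⟩
      γ ⊗ emb (x +ℤ[ζ] y)            ≈⟨ ⊗-congˡ γ (emb-+ x y) ⟩
      γ ⊗ (emb x ⊕ emb y)            ≈⟨ ≐⇒∼ (⊗-distribˡ-⊕ γ (emb x) (emb y)) ⟩
      (γ ⊗ emb x) ⊕ (γ ⊗ emb y)      ≈⟨ ⊕-cong (emb-mul x) (emb-mul y) ⟨
      emb (mul x) ⊕ emb (mul y)      ≈⟨ emb-+ (mul x) (mul y) ⟨
      emb (mul x +ℤ[ζ] mul y)        ∎)
      where open ∼-Reasoning

    emb∼γ⁻¹⊗emb-mul : ∀ x → emb x ∼ γ⁻¹ ⊗ emb (mul x)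
    emb∼γ⁻¹⊗emb-mul x = begin
      emb x                   ≈⟨ identityˡ (emb x) ⟨
      one ⊗ emb x             ≈⟨ ⊗-congʳ (emb x) γ⁻¹⊗γ ⟨
      (γ⁻¹ ⊗ γ) ⊗ emb x       ≈⟨ assoc γ⁻¹ γ (emb x) ⟩
      γ⁻¹ ⊗ (γ ⊗ emb x)       ≈⟨ ⊗-congˡ γ⁻¹ (emb-mul x) ⟨
      γ⁻¹ ⊗ emb (mul x)       ∎
      where open ∼-Reasoning

    mul-injective : ∀ x y → mul x ≡ mul y → x ≡ y
    mul-injective x y mul-x≡mul-y = emb-injective (∼-trans (emb∼γ⁻¹⊗emb-mul x)
      (∼-trans (⊗-congˡ γ⁻¹ (≐⇒∼ (λ j _ → cong (λ z → emb z j) mul-x≡mul-y))) (∼-sym (emb∼γ⁻¹⊗emb-mul y))))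

    mul-∈ideal : ∀ x → InCraigIdeal k (mul x)
    mul-∈ideal x =
      let y , emb-y∼u⊗emb-x = integral⇒emb (integral-⊗ u-integral (integral-emb x)) in
      y , _∼_.un∼ (begin
        emb (mul x)             ≈⟨ emb-mul x ⟩
        γ ⊗ emb x               ≈⟨ ⊗-congʳ (emb x) γ-factor ⟩
        ([1-ζ]^k ⊗ u) ⊗ emb x   ≈⟨ assoc [1-ζ]^k u (emb x) ⟩
        [1-ζ]^k ⊗ (u ⊗ emb x)   ≈⟨ ⊗-congˡ [1-ζ]^k emb-y∼u⊗emb-x ⟨
        [1-ζ]^k ⊗ emb y         ∎)
      where open ∼-Reasoning

    mul-surjective : ∀ z → InCraigIdeal k z → Σ ℤ[ζ] λ x → mul x ≡ z
    mul-surjective z (y , emb-z≈) =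
      let x , emb-x∼v⊗emb-y = integral⇒emb (integral-⊗ v-integral (integral-emb y)) in
      x , emb-injective (begin
        emb (mul x)             ≈⟨ emb-mul x ⟩
        γ ⊗ emb x               ≈⟨ ⊗-congˡ γ emb-x∼v⊗emb-y ⟩
        γ ⊗ (v ⊗ emb y)         ≈⟨ assoc γ v (emb y) ⟨
        (γ ⊗ v) ⊗ emb y         ≈⟨ ⊗-congʳ (emb y) γ⊗v ⟩
        [1-ζ]^k ⊗ emb y         ≈⟨ mk∼ emb-z≈ ⟨
        emb z                   ∎)
      where open ∼-Reasoning

    mul-⊗-conj : ∀ x y → emb (mul x) ⊗ conj (emb (mul y)) ∼ (γ ⊗ conj γ) ⊗ (emb x ⊗ conj (emb y))
    mul-⊗-conj x y = begin
      emb (mul x) ⊗ conj (emb (mul y))          ≈⟨ ⊗-cong (emb-mul x) (conj-cong (emb-mul y)) ⟩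
      (γ ⊗ emb x) ⊗ conj (γ ⊗ emb y)            ≈⟨ ⊗-congˡ (γ ⊗ emb x) (≐⇒∼ (conj-⊗ γ (emb y))) ⟩
      (γ ⊗ emb x) ⊗ (conj γ ⊗ conj (emb y))     ≈⟨ interchange γ (emb x) (conj γ) (conj (emb y)) ⟩
      (γ ⊗ conj γ) ⊗ (emb x ⊗ conj (emb y))     ∎
      where open ∼-Reasoning

    isometricToScaledCraig : ∀ c β → β ∼ (c ℚ.* (+ 1 / ℓ)) · (γ ⊗ conj γ) → IsometricToScaledCraig β c k
    isometricToScaledCraig c β β∼ = mul , mul-+ , mul-injective , mul-∈ideal , mul-surjective , form
      where
      form : ∀ x y → ⟨ x , y ⟩[ β ] ≡ c ℚ.* craigForm (mul x) (mul y)
      form x y = begin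
        tr (β ⊗ P)                                     ≡⟨ tr-cong (⊗-congʳ P β∼) ⟩
        tr (((c ℚ.* 1/ℓ) · (γ ⊗ conj γ)) ⊗ P)          ≡⟨ tr-cong (≐⇒∼ (·-⊗ (c ℚ.* 1/ℓ) (γ ⊗ conj γ) P)) ⟩
        tr ((c ℚ.* 1/ℓ) · ((γ ⊗ conj γ) ⊗ P))          ≡⟨ tr-· (c ℚ.* 1/ℓ) ((γ ⊗ conj γ) ⊗ P) ⟩
        (c ℚ.* 1/ℓ) ℚ.* tr ((γ ⊗ conj γ) ⊗ P)          ≡⟨ ℚₚ.*-assoc c 1/ℓ _ ⟩
        c ℚ.* (1/ℓ ℚ.* tr ((γ ⊗ conj γ) ⊗ P))          ≡⟨ cong (λ t → c ℚ.* (1/ℓ ℚ.* t)) (tr-cong (mul-⊗-conj x y)) ⟨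
        c ℚ.* (1/ℓ ℚ.* tr (emb (mul x) ⊗ conj (emb (mul y))))
                                                       ≡⟨ cong (c ℚ.*_) (tr-· 1/ℓ _) ⟨
        c ℚ.* craigForm (mul x) (mul y)                ∎
        where
        open ≡-Reasoning
        1/ℓ : ℚ
        1/ℓ = + 1 / ℓ
        P : K
        P = emb x ⊗ conj (emb y)

module OddCyclotomic
  (ℓ : ℕ) .{{_ : NonZero ℓ}} (1<ℓ : 1 < ℓ) (m : ℕ) (ℓ-1≡m*2 : ℓ ∸ 1 ≡ m * 2) where

  open Cyclotomic ℓ
  open IndexArithmetic ℓ
  open GroupAlgebra ℓ
  open Integrality ℓ
  open MultiplicationByGenerator ℓ using (isometricToScaledCraig)

  n : ℕ
  n = ℓ ∸ 1

  −1 : ℚ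
  −1 = ℚ.- 1ℚ

  ζ ζ⁻¹ 1-ζ 1+ζ ζ-ζ⁻¹ : K
  ζ     = ζ^ 1
  ζ⁻¹   = ζ^ n
  1-ζ   = one ⊖ ζ
  1+ζ   = one ⊕ ζ
  ζ-ζ⁻¹ = ζ ⊖ ζ⁻¹

  1%ℓ≡1 : 1 % ℓ ≡ 1
  1%ℓ≡1 = m<n⇒m%n≡m 1<ℓ

  ζ⊗-at : ∀ a k → (ζ ⊗ a) k ≡ a (k ⊟ 1)
  ζ⊗-at a k = trans (ζ^-⊗ 1 a k) (cong (λ j → a (k ⊟ j)) 1%ℓ≡1)

  0⊟1≡n : 0 ⊟ 1 ≡ n
  0⊟1≡n = m<n⇒m%n≡m ℓ-1<ℓ

  suc⊟1 : ∀ k → suc k < ℓ → suc k ⊟ 1 ≡ k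
  suc⊟1 k 1+k<ℓ = ⊟-unique (ℕₚ.<⇒≤ 1<ℓ) (ℕₚ.<-trans (ℕₚ.n<1+n k) 1+k<ℓ) (cong (_% ℓ) (ℕₚ.+-comm k 1))

  one-0 : one 0 ≡ 1ℚ
  one-0 = ζ^-≡1 0 0 (sym (m<n⇒m%n≡m 0<ℓ))

  one-suc : ∀ k → suc k < ℓ → one (suc k) ≡ 0ℚ
  one-suc k _ = ζ^-≡0 0 (suc k) (λ 1+k≡0%ℓ → ℕₚ.1+n≢0 (trans 1+k≡0%ℓ (m<n⇒m%n≡m 0<ℓ)))

  ≐-by-cases : ∀ {a b} → a 0 ≡ b 0 → (∀ k → suc k < ℓ → a (suc k) ≡ b (suc k)) → a ≐ b
  ≐-by-cases a0≡b0 _     zero    _     = a0≡b0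
  ≐-by-cases _     a+≡b+ (suc k) 1+k<ℓ = a+≡b+ k 1+k<ℓ

  1+ζ⊗-at : ∀ c k → k < ℓ → (1+ζ ⊗ c) k ≡ c k ℚ.+ c (k ⊟ 1)
  1+ζ⊗-at c k k<ℓ = trans (⊗-distribʳ-⊕ one ζ c k k<ℓ) (cong₂ ℚ._+_ (⊗-identityˡ c k k<ℓ) (ζ⊗-at c k))

  1-ζ⊗-at : ∀ c k → k < ℓ → (1-ζ ⊗ c) k ≡ c k ℚ.- c (k ⊟ 1)
  1-ζ⊗-at c k k<ℓ = trans (⊗-distribʳ-⊖ one ζ c k k<ℓ) (cong₂ ℚ._-_ (⊗-identityˡ c k k<ℓ) (ζ⊗-at c k))

  alternating : ℕ → ℤ
  alternating zero          = + 1
  alternating (suc zero)    = + 0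
  alternating (suc (suc k)) = alternating k

  alternating-even : ∀ j → alternating (j * 2) ≡ + 1
  alternating-even zero    = refl
  alternating-even (suc j) = alternating-even j

  [1+ζ]⁻¹ : K
  [1+ζ]⁻¹ k = ℤ→ℚ (alternating k)

  -- ℓ - 1 is even, so [1+ζ]⁻¹ has coefficient 1 at both 0 and ℓ - 1:
  -- (1 + ζ) [1+ζ]⁻¹ is 1 plus the all-ones vector.
  1+ζ⊗[1+ζ]⁻¹ : 1+ζ ⊗ [1+ζ]⁻¹ ∼ one
  1+ζ⊗[1+ζ]⁻¹ = shift⇒∼ 1ℚ (≐-by-cases at-0 at-suc)
    where
    open ≡-Reasoning
    at-0 : (1+ζ ⊗ [1+ζ]⁻¹) 0 ≡ one 0 ℚ.+ 1ℚ
    at-0 = begin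
      (1+ζ ⊗ [1+ζ]⁻¹) 0               ≡⟨ 1+ζ⊗-at [1+ζ]⁻¹ 0 0<ℓ ⟩
      1ℚ ℚ.+ [1+ζ]⁻¹ (0 ⊟ 1)          ≡⟨ cong (λ j → 1ℚ ℚ.+ [1+ζ]⁻¹ j) (trans 0⊟1≡n ℓ-1≡m*2) ⟩
      1ℚ ℚ.+ ℤ→ℚ (alternating (m * 2)) ≡⟨ cong (λ z → 1ℚ ℚ.+ ℤ→ℚ z) (alternating-even m) ⟩
      1ℚ ℚ.+ 1ℚ                        ≡⟨ cong (ℚ._+ 1ℚ) one-0 ⟨
      one 0 ℚ.+ 1ℚ                     ∎
    alternating-adjacent : ∀ k → [1+ζ]⁻¹ (suc k) ℚ.+ [1+ζ]⁻¹ k ≡ 1ℚ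
    alternating-adjacent zero          = refl
    alternating-adjacent (suc zero)    = refl
    alternating-adjacent (suc (suc k)) = alternating-adjacent k
    at-suc : ∀ k → suc k < ℓ → (1+ζ ⊗ [1+ζ]⁻¹) (suc k) ≡ one (suc k) ℚ.+ 1ℚ
    at-suc k 1+k<ℓ = begin
      (1+ζ ⊗ [1+ζ]⁻¹) (suc k)                   ≡⟨ 1+ζ⊗-at [1+ζ]⁻¹ (suc k) 1+k<ℓ ⟩
      [1+ζ]⁻¹ (suc k) ℚ.+ [1+ζ]⁻¹ (suc k ⊟ 1)   ≡⟨ cong (λ j → [1+ζ]⁻¹ (suc k) ℚ.+ [1+ζ]⁻¹ j) (suc⊟1 k 1+k<ℓ) ⟩
      [1+ζ]⁻¹ (suc k) ℚ.+ [1+ζ]⁻¹ k             ≡⟨ alternating-adjacent k ⟩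
      1ℚ                                        ≡⟨ ℚₚ.+-identityˡ 1ℚ ⟨
      0ℚ ℚ.+ 1ℚ                                 ≡⟨ cong (ℚ._+ 1ℚ) (one-suc k 1+k<ℓ) ⟨
      one (suc k) ℚ.+ 1ℚ                        ∎

  1/ℓ : ℚ
  1/ℓ = + 1 / ℓ

  [1-ζ]⁻¹ : K
  [1-ζ]⁻¹ k = ℚ.- (ℕ→ℚ k ℚ.* 1/ℓ)

  -- (1 - ζ) [1-ζ]⁻¹ is 1 minus the all-(1/ℓ) vector.
  1-ζ⊗[1-ζ]⁻¹ : 1-ζ ⊗ [1-ζ]⁻¹ ∼ one
  1-ζ⊗[1-ζ]⁻¹ = shift⇒∼ (ℚ.- 1/ℓ) (≐-by-cases at-0 at-suc)
    where
    open ≡-Reasoning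
    at-0 : (1-ζ ⊗ [1-ζ]⁻¹) 0 ≡ one 0 ℚ.+ ℚ.- 1/ℓ
    at-0 = begin
      (1-ζ ⊗ [1-ζ]⁻¹) 0                                   ≡⟨ 1-ζ⊗-at [1-ζ]⁻¹ 0 0<ℓ ⟩
      [1-ζ]⁻¹ 0 ℚ.- [1-ζ]⁻¹ (0 ⊟ 1)                       ≡⟨ cong (λ j → [1-ζ]⁻¹ 0 ℚ.- [1-ζ]⁻¹ j) 0⊟1≡n ⟩
      ℚ.- (0ℚ ℚ.* 1/ℓ) ℚ.- ℚ.- (ℕ→ℚ n ℚ.* 1/ℓ)            ≡⟨ solve 2 (λ p t → :- (con 0ℚ :* t) :- :- (p :* t) := (p :+ con 1ℚ) :* t :+ :- t) refl (ℕ→ℚ n) 1/ℓ ⟩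
      (ℕ→ℚ n ℚ.+ 1ℚ) ℚ.* 1/ℓ ℚ.+ ℚ.- 1/ℓ                  ≡⟨ cong (λ p → p ℚ.* 1/ℓ ℚ.+ ℚ.- 1/ℓ) (sym (ℕ→ℚ-suc n)) ⟩
      ℕ→ℚ (suc n) ℚ.* 1/ℓ ℚ.+ ℚ.- 1/ℓ                     ≡⟨ cong (λ p → ℕ→ℚ p ℚ.* 1/ℓ ℚ.+ ℚ.- 1/ℓ) (ℕₚ.suc-pred ℓ) ⟩
      ℕ→ℚ ℓ ℚ.* 1/ℓ ℚ.+ ℚ.- 1/ℓ                           ≡⟨ cong (ℚ._+ ℚ.- 1/ℓ) (trans (ℕ→ℚ-*-1/ ℓ) (sym one-0)) ⟩
      one 0 ℚ.+ ℚ.- 1/ℓ                                   ∎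
    at-suc : ∀ k → suc k < ℓ → (1-ζ ⊗ [1-ζ]⁻¹) (suc k) ≡ one (suc k) ℚ.+ ℚ.- 1/ℓ
    at-suc k 1+k<ℓ = begin
      (1-ζ ⊗ [1-ζ]⁻¹) (suc k)                             ≡⟨ 1-ζ⊗-at [1-ζ]⁻¹ (suc k) 1+k<ℓ ⟩
      [1-ζ]⁻¹ (suc k) ℚ.- [1-ζ]⁻¹ (suc k ⊟ 1)             ≡⟨ cong₂ (λ p j → ℚ.- (p ℚ.* 1/ℓ) ℚ.- [1-ζ]⁻¹ j) (ℕ→ℚ-suc k) (suc⊟1 k 1+k<ℓ) ⟩
      ℚ.- ((ℕ→ℚ k ℚ.+ 1ℚ) ℚ.* 1/ℓ) ℚ.- ℚ.- (ℕ→ℚ k ℚ.* 1/ℓ) ≡⟨ solve 2 (λ p t → :- ((p :+ con 1ℚ) :* t) :- :- (p :* t) := con 0ℚ :+ :- t) refl (ℕ→ℚ k) 1/ℓ ⟩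
      0ℚ ℚ.+ ℚ.- 1/ℓ                                      ≡⟨ cong (ℚ._+ ℚ.- 1/ℓ) (one-suc k 1+k<ℓ) ⟨
      one (suc k) ℚ.+ ℚ.- 1/ℓ                             ∎

  ζ⁻¹⊗ζ : ζ⁻¹ ⊗ ζ ∼ one
  ζ⁻¹⊗ζ = ∼-trans (≐⇒∼ (ζ^-+ n 1)) (≐⇒∼ λ k _ → ζ^-≡ₘ k (begin
    (n + 1) % ℓ        ≡⟨ cong (_% ℓ) (ℕₚ.+-comm n 1) ⟩
    suc n % ℓ          ≡⟨ cong (_% ℓ) (ℕₚ.suc-pred ℓ) ⟩
    ℓ % ℓ              ≡⟨ n%n≡0 ℓ ⟩
    0                  ≡⟨ m<n⇒m%n≡m 0<ℓ ⟨
    0 % ℓ              ∎))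
    where open ≡-Reasoning

  ζ⁻¹⊗ζ^2 : ζ⁻¹ ⊗ ζ^ 2 ∼ ζ
  ζ⁻¹⊗ζ^2 = ∼-trans (≐⇒∼ (ζ^-+ n 2)) (≐⇒∼ λ k _ → ζ^-≡ₘ k (begin
    (n + 2) % ℓ        ≡⟨ cong (_% ℓ) (ℕₚ.+-comm n 2) ⟩
    (1 + suc n) % ℓ    ≡⟨ cong (λ j → (1 + j) % ℓ) (ℕₚ.suc-pred ℓ) ⟩
    (1 + ℓ) % ℓ        ≡⟨ [m+n]%n≡m%n 1 ℓ ⟩
    1 % ℓ              ∎))
    where open ≡-Reasoning

  1-ζ⊗1+ζ : 1-ζ ⊗ 1+ζ ∼ one ⊖ ζ^ 2
  1-ζ⊗1+ζ = begin
    1-ζ ⊗ 1+ζ                            ≈⟨ ≐⇒∼ (⊗-distribʳ-⊖ one ζ 1+ζ) ⟩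
    (one ⊗ 1+ζ) ⊖ (ζ ⊗ 1+ζ)              ≈⟨ ⊖-cong (identityˡ 1+ζ) (≐⇒∼ (⊗-distribˡ-⊕ ζ one ζ)) ⟩
    1+ζ ⊖ ((ζ ⊗ one) ⊕ (ζ ⊗ ζ))          ≈⟨ ⊖-cong (∼-refl {1+ζ}) (⊕-cong (identityʳ ζ) (≐⇒∼ (ζ^-+ 1 1))) ⟩
    1+ζ ⊖ (ζ ⊕ ζ^ 2)                     ≈⟨ ≐⇒∼ (λ k _ → solve 3 (λ x y z → (x :+ y) :- (y :+ z) := x :- z) refl (one k) (ζ k) (ζ^ 2 k)) ⟩
    one ⊖ ζ^ 2                           ∎
    where open ∼-Reasoning

  ζ⁻¹[1+ζ] ζ[1+ζ]⁻¹ : K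
  ζ⁻¹[1+ζ] = ζ⁻¹ ⊗ 1+ζ
  ζ[1+ζ]⁻¹ = ζ ⊗ [1+ζ]⁻¹

  ζ-ζ⁻¹-factor : ζ-ζ⁻¹ ∼ −1 · (1-ζ ⊗ ζ⁻¹[1+ζ])
  ζ-ζ⁻¹-factor = begin
    ζ ⊖ ζ⁻¹                               ≈⟨ ≐⇒∼ (λ k _ → solve 2 (λ x y → x :- y := con −1 :* (y :- x)) refl (ζ k) (ζ⁻¹ k)) ⟩
    −1 · (ζ⁻¹ ⊖ ζ)                        ≈⟨ ·-congˡ −1 (⊖-cong (identityʳ ζ⁻¹) ζ⁻¹⊗ζ^2) ⟨
    −1 · ((ζ⁻¹ ⊗ one) ⊖ (ζ⁻¹ ⊗ ζ^ 2))     ≈⟨ ·-congˡ −1 (≐⇒∼ (⊗-distribˡ-⊖ ζ⁻¹ one (ζ^ 2))) ⟨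
    −1 · (ζ⁻¹ ⊗ (one ⊖ ζ^ 2))             ≈⟨ ·-congˡ −1 (⊗-congˡ ζ⁻¹ 1-ζ⊗1+ζ) ⟨
    −1 · (ζ⁻¹ ⊗ (1-ζ ⊗ 1+ζ))              ≈⟨ ·-congˡ −1 (x∙yz≈y∙xz ζ⁻¹ 1-ζ 1+ζ) ⟩
    −1 · (1-ζ ⊗ ζ⁻¹[1+ζ])                 ∎
    where open ∼-Reasoning

  ζ⁻¹[1+ζ]⊗ζ[1+ζ]⁻¹ : ζ⁻¹[1+ζ] ⊗ ζ[1+ζ]⁻¹ ∼ one
  ζ⁻¹[1+ζ]⊗ζ[1+ζ]⁻¹ = begin
    (ζ⁻¹ ⊗ 1+ζ) ⊗ (ζ ⊗ [1+ζ]⁻¹)      ≈⟨ interchange ζ⁻¹ 1+ζ ζ [1+ζ]⁻¹ ⟩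
    (ζ⁻¹ ⊗ ζ) ⊗ (1+ζ ⊗ [1+ζ]⁻¹)      ≈⟨ ⊗-cong ζ⁻¹⊗ζ 1+ζ⊗[1+ζ]⁻¹ ⟩
    one ⊗ one                        ≈⟨ identityˡ one ⟩
    one                              ∎
    where open ∼-Reasoning

  neg-^-n : ∀ a → (−1 · a) ^^ n ∼ a ^^ n
  neg-^-n a = subst (λ j → (−1 · a) ^^ j ∼ a ^^ j) (sym ℓ-1≡m*2) (neg-^-even a m)

  γ : K
  γ = ζ-ζ⁻¹ ^^ n

  γ-factor′ : γ ∼ (1-ζ ⊗ ζ⁻¹[1+ζ]) ^^ n
  γ-factor′ = ∼-trans (^-cong n ζ-ζ⁻¹-factor) (neg-^-n (1-ζ ⊗ ζ⁻¹[1+ζ]))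

  γ-factor : γ ∼ (1-ζ ^^ n) ⊗ (ζ⁻¹[1+ζ] ^^ n)
  γ-factor = ∼-trans γ-factor′ (^-distribʳ-⊗ 1-ζ ζ⁻¹[1+ζ] n)

  γ⊗[ζ[1+ζ]⁻¹]^n : γ ⊗ (ζ[1+ζ]⁻¹ ^^ n) ∼ 1-ζ ^^ n
  γ⊗[ζ[1+ζ]⁻¹]^n = begin
    γ ⊗ v                            ≈⟨ ⊗-congʳ v γ-factor ⟩
    ((1-ζ ^^ n) ⊗ u) ⊗ v             ≈⟨ assoc (1-ζ ^^ n) u v ⟩
    (1-ζ ^^ n) ⊗ (u ⊗ v)             ≈⟨ ⊗-congˡ (1-ζ ^^ n) (^-distribʳ-⊗ ζ⁻¹[1+ζ] ζ[1+ζ]⁻¹ n) ⟨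
    (1-ζ ^^ n) ⊗ ((ζ⁻¹[1+ζ] ⊗ ζ[1+ζ]⁻¹) ^^ n)
                                     ≈⟨ ⊗-congˡ (1-ζ ^^ n) (∼-trans (^-cong n ζ⁻¹[1+ζ]⊗ζ[1+ζ]⁻¹) (one-^ n)) ⟩
    (1-ζ ^^ n) ⊗ one                 ≈⟨ identityʳ (1-ζ ^^ n) ⟩
    1-ζ ^^ n                         ∎
    where
    open ∼-Reasoning
    u v : K
    u = ζ⁻¹[1+ζ] ^^ n
    v = ζ[1+ζ]⁻¹ ^^ n

  γ⁻¹ : K
  γ⁻¹ = ([1-ζ]⁻¹ ⊗ ζ[1+ζ]⁻¹) ^^ n

  γ⁻¹⊗γ : γ⁻¹ ⊗ γ ∼ one
  γ⁻¹⊗γ = begin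
    γ⁻¹ ⊗ γ                                              ≈⟨ ⊗-congˡ γ⁻¹ γ-factor′ ⟩
    (([1-ζ]⁻¹ ⊗ ζ[1+ζ]⁻¹) ^^ n) ⊗ ((1-ζ ⊗ ζ⁻¹[1+ζ]) ^^ n) ≈⟨ ^-distribʳ-⊗ ([1-ζ]⁻¹ ⊗ ζ[1+ζ]⁻¹) (1-ζ ⊗ ζ⁻¹[1+ζ]) n ⟨
    (([1-ζ]⁻¹ ⊗ ζ[1+ζ]⁻¹) ⊗ (1-ζ ⊗ ζ⁻¹[1+ζ])) ^^ n       ≈⟨ ^-cong n (interchange [1-ζ]⁻¹ ζ[1+ζ]⁻¹ 1-ζ ζ⁻¹[1+ζ]) ⟩
    (([1-ζ]⁻¹ ⊗ 1-ζ) ⊗ (ζ[1+ζ]⁻¹ ⊗ ζ⁻¹[1+ζ])) ^^ n       ≈⟨ ^-cong n (⊗-cong (∼-trans (comm [1-ζ]⁻¹ 1-ζ) 1-ζ⊗[1-ζ]⁻¹)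
                                                                              (∼-trans (comm ζ[1+ζ]⁻¹ ζ⁻¹[1+ζ]) ζ⁻¹[1+ζ]⊗ζ[1+ζ]⁻¹)) ⟩
    (one ⊗ one) ^^ n                                     ≈⟨ ^-cong n (identityˡ one) ⟩
    one ^^ n                                             ≈⟨ one-^ n ⟩
    one                                                  ∎
    where open ∼-Reasoning

  conj-ζ-ζ⁻¹ : conj ζ-ζ⁻¹ ∼ −1 · ζ-ζ⁻¹
  conj-ζ-ζ⁻¹ = ≐⇒∼ λ k k<ℓ → begin
    conj ζ k ℚ.- conj ζ⁻¹ k        ≡⟨ cong₂ ℚ._-_ (trans (conj-ζ^ 1 k k<ℓ) (cong (λ j → ζ^ (ℓ ∸ j) k) 1%ℓ≡1))
                                                 (trans (conj-ζ^ n k k<ℓ) (cong (λ j → ζ^ (ℓ ∸ j) k) (m<n⇒m%n≡m ℓ-1<ℓ))) ⟩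
    ζ⁻¹ k ℚ.- ζ^ (ℓ ∸ n) k          ≡⟨ cong (λ j → ζ⁻¹ k ℚ.- ζ^ j k) (ℕₚ.m∸[m∸n]≡n (ℕₚ.<⇒≤ 1<ℓ)) ⟩
    ζ⁻¹ k ℚ.- ζ k                   ≡⟨ solve 2 (λ x y → x :- y := con −1 :* (y :- x)) refl (ζ⁻¹ k) (ζ k) ⟩
    −1 ℚ.* (ζ k ℚ.- ζ⁻¹ k)          ∎
    where open ≡-Reasoning

  γ⊗conj-γ : γ ⊗ conj γ ∼ ζ-ζ⁻¹ ^^ (2 * n)
  γ⊗conj-γ = begin
    γ ⊗ conj γ                     ≈⟨ ⊗-congˡ γ (conj-^ ζ-ζ⁻¹ n) ⟩
    γ ⊗ (conj ζ-ζ⁻¹ ^^ n)          ≈⟨ ⊗-congˡ γ (∼-trans (^-cong n conj-ζ-ζ⁻¹) (neg-^-n ζ-ζ⁻¹)) ⟩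
    γ ⊗ γ                          ≈⟨ ^-homo-+ ζ-ζ⁻¹ n n ⟨
    ζ-ζ⁻¹ ^^ (n + n)               ≡⟨ cong (λ j → ζ-ζ⁻¹ ^^ (n + j)) (ℕₚ.+-identityʳ n) ⟨
    ζ-ζ⁻¹ ^^ (2 * n)               ∎
    where open ∼-Reasoning

  γ-integral : IsIntegral γ
  γ-integral = integral-^ (integral-⊖ (integral-ζ^ 1) (integral-ζ^ n)) n

  α-isometric : IsometricToScaledCraig α 1/ℓ n
  α-isometric = isometricToScaledCraig n γ γ-integral γ⁻¹ γ⁻¹⊗γ
    (ζ⁻¹[1+ζ] ^^ n) (integral-^ (integral-⊗ (integral-ζ^ n) (integral-⊕ (integral-ζ^ 0) (integral-ζ^ 1))) n) γ-factor
    (ζ[1+ζ]⁻¹ ^^ n) (integral-^ (integral-⊗ (integral-ζ^ 1) (alternating , ∼-refl)) n) γ⊗[ζ[1+ζ]⁻¹]^n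
    1/ℓ α (·-congˡ (1/ℓ ℚ.* 1/ℓ) (∼-sym γ⊗conj-γ))

parity : ∀ n → Σ ℕ λ m → n ≡ m * 2 ⊎ n ≡ suc (m * 2)
parity zero    = 0 , inj₁ refl
parity (suc n) with parity n
... | m , inj₁ n≡m*2   = m , inj₂ (cong suc n≡m*2)
... | m , inj₂ n≡1+m*2 = suc m , inj₁ (cong suc n≡1+m*2)

odd-prime-pred-even : ∀ {p} → Prime p → p ≢ 2 → Σ ℕ λ m → p ∸ 1 ≡ m * 2
odd-prime-pred-even {p} p-prime p≢2 with parity p
... | m , inj₁ p≡m*2   =
  contradiction (composite-≢ 2 {{_}} {{prime⇒nonZero p-prime}} (≢-sym p≢2) (divides m p≡m*2)) (Prime.notComposite p-prime)
... | m , inj₂ p≡1+m*2 = m , cong (_∸ 1) p≡1+m*2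

lemma2p16 : (ℓ : ℕ) .{{_ : NonZero ℓ}} → Prime ℓ → ℓ ≢ 2 →
    Cyclotomic.IsometricToScaledCraig ℓ (Cyclotomic.α ℓ) ((+ 1) / ℓ) (ℓ ∸ 1)
lemma2p16 ℓ ℓ-prime ℓ≢2 =
  let m , ℓ-1≡m*2 = odd-prime-pred-even ℓ-prime ℓ≢2 in
  OddCyclotomic.α-isometric ℓ (nonTrivial⇒n>1 ℓ {{prime⇒nonTrivial ℓ-prime}}) m ℓ-1≡m*2
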